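{- Let $0\le i<n$ and let $a$ be a weak composition with $a_i>a_{i+1}$ if $i\ge1$, and with $a_n\ge a_1>0$ if $i=0$. Then $\mathcal{E}_i(T)\in\mathrm{SSKD}(s_i\cdot a)$ for every $T\in\mathrm{SSKD}(a)$.
   Context: Fix $n\ge 2$. A weak composition is $a=(a_1,\ldots,a_n)\in\mathbb{Z}_{\ge0}^n$. For $1\le i<n$, $s_i\cdot a$ exchanges $a_i$ and $a_{i+1}$; $s_0\cdot a=(a_n+1,a_2,\ldots,a_{n-1},a_1-1)$. The diagram of $a$ has $a_r$ cells left-justified in row $r$ (row $1$ at the bottom), in columns $1,\dots,a_r$; there is also a basement column $0$ whose cell in row $r$ has entry $r$. A filling assigns an entry in $\{1,\ldots,n\}$ to each cell. A filling is non-attacking if no two cells with the same entry lie in the same column, and no two cells with the same entry lie in adjacent columns $c,c+1$ with the cell in column $c$ in a strictly higher row. A triple consists of three cells (basement allowed): two cells in row $r$ in adjacent columns $c,c+1$, and a third cell either (Type I) in column $c$ in a row $s>r$ with $a_r>a_s$, or (Type II) in column $c+1$ in a row $s<r$ with $a_r\ge a_s$ (row lengths in the shape of the filling). Entries are compared as integers (basement entry = row index), equal entries being compared by regarding the one further right as smaller. For Type I let $\alpha,\beta,\gamma$ be the entries of the lower-left, lower-right, upper cell; for Type II of the upper-left, upper-right, lower cell. It is a co-inversion triple if $\alpha<\beta<\gamma$ or $\beta<\gamma<\alpha$ or $\gamma<\alpha<\beta$. $\mathrm{SSKD}(a)$ is the set of non-attacking fillings of the diagram of $a$ with no co-inversion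 triples. $\mathcal{E}_i$ for $1\le i<n$ (when $a_i>a_{i+1}$): $\mathcal{E}_i(T)$ is a filling of the diagram of $s_i\cdot a$. For $k=0,\ldots,a_{i+1}$ let $y_k,x_k$ be the entries of $T$ in rows $i+1,i$ of column $k$ (column $0$ the basement, fixed). Inductively for $k=0,\ldots,a_{i+1}-1$: if in column $k$ of $\mathcal{E}_i(T)$ the entry $y_k$ is above $x_k$, put $y_{k+1}$ in row $i+1$ and $x_{k+1}$ in row $i$ of column $k+1$, unless this makes $y_k,y_{k+1},x_{k+1}$ (cells row $i+1$ col $k$, row $i+1$ col $k+1$, row $i$ col $k+1$) a Type II co-inversion triple, in which case put $x_{k+1}$ in row $i+1$ and $y_{k+1}$ in row $i$; otherwise ($x_k$ above $y_k$) put $x_{k+1}$ in row $i+1$ and $y_{k+1}$ in row $i$, unless this makes $x_k,x_{k+1},y_{k+1}$ a Type II co-inversion triple, in which case put $y_{k+1}$ in row $i+1$ and $x_{k+1}$ in row $i$. Entries of row $i$ of $T$ in columns $a_{i+1}+1,\ldots,a_i$ go to the same columns of row $i+1$; other rows are copied. $\mathcal{E}_0$ (when $a_n\ge a_1>0$): $\mathcal{E}_0(T)$ is a filling of the diagram of $s_0\cdot a$. Let $y_k,x_k$ be the entries of $T$ in rows $n,1$ of column $k$. Rows $2,\ldots,n-1$ are copied; row $1$, column $1$ gets $x_1$. Inductively for $k=1,\ldots,a_1-1$: if row $1$, column $k$ of $\mathcal{E}_0(T)$ contains $x_k$, put $y_k$ in row $n$ column $k$ and $x_{k+1}$ in row $1$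 column $k+1$, unless the cells (row $1$, col $k$), (row $1$, col $k+1$), (row $n$, col $k$) then form a Type I co-inversion triple or contain an attacking pair, in which case put $x_{k+1}$ in row $n$ column $k$ and $y_k$ in row $1$ column $k+1$; otherwise (row $1$ column $k$ contains $y_{k-1}$) put $x_{k+1}$ in row $n$ column $k$ and $y_k$ in row $1$ column $k+1$, unless those three cells then form a Type I co-inversion triple or contain an attacking pair, in which case put $y_k$ in row $n$ column $k$ and $x_{k+1}$ in row $1$ column $k+1$. Finally $y_{a_1},\ldots,y_{a_n}$ are placed in row $1$, columns $a_1+1,\ldots,a_n+1$. -}

module Defs where

open import Data.Nat using (ℕ; zero; suc; _+_; _∸_; _≤_; _<_; _≤ᵇ_; _<ᵇ_; _≡ᵇ_)
open import Data.Bool using (Bool; true; false; if_then_else_; _∧_; _∨_; not)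
open import Data.Vec using (Vec; []; _∷_; tabulate)
open import Data.Fin using (Fin; toℕ)
open import Data.Product using (_×_)
open import Relation.Binary.PropositionalEquality using (_≡_)

-- Weak compositions a = (a_1,…,a_n) are vectors Vec ℕ n.
-- Rows are numbered 1..n; `row a r` is a_r (and 0 outside 1..n).

at : ∀ {m} → Vec ℕ m → ℕ → ℕ
at []       _       = 0
at (x ∷ xs) zero    = x
at (x ∷ xs) (suc r) = at xs r

row : ∀ {n} → Vec ℕ n → ℕ → ℕ
row a zero    = 0
row a (suc r) = at a r

sAct : (n i : ℕ) → Vec ℕ n → Vec ℕ n
sAct n zero a = tabulate λ (j : Fin n) → f (suc (toℕ j))
  where
  f : ℕ → ℕ
  f r = if r ≡ᵇ 1 then row a n + 1
        else if r ≡ᵇ n then row a 1 ∸ 1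
        else row a r
sAct n (suc j) a = tabulate λ (k : Fin n) → f (suc (toℕ k))
  where
  i = suc j
  f : ℕ → ℕ
  f r = if r ≡ᵇ i then row a (i + 1)
        else if r ≡ᵇ i + 1 then row a i
        else row a r

-- Fillings: T r c is the entry in row r, column c (c ≥ 1).
-- Only the values on cells of the diagram matter.
-- The basement column 0 has entry r in row r.

Filling : Set
Filling = ℕ → ℕ → ℕ

ent : Filling → ℕ → ℕ → ℕ
ent T r zero    = r
ent T r (suc c) = T r (suc c)

Cell : (n : ℕ) → Vec ℕ n → ℕ → ℕ → Set
Cell n a r c = 1 ≤ r × r ≤ n × c ≤ row a r

Box : (n : ℕ) → Vec ℕ n → ℕ → ℕ → Set
Box n a r c = Cell n a r c × 1 ≤ c

ltB : ℕ → ℕ → ℕ → ℕ → Bool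
ltB e1 c1 e2 c2 = (e1 <ᵇ e2) ∨ ((e1 ≡ᵇ e2) ∧ (c2 <ᵇ c1))

coinvB : (α cα β cβ γ cγ : ℕ) → Bool
coinvB α cα β cβ γ cγ =
  (ltB α cα β cβ ∧ ltB β cβ γ cγ) ∨
  (ltB β cβ γ cγ ∧ ltB γ cγ α cα) ∨
  (ltB γ cγ α cα ∧ ltB α cα β cβ)

attackB : (r1 c1 e1 r2 c2 e2 : ℕ) → Bool
attackB r1 c1 e1 r2 c2 e2 =
  (e1 ≡ᵇ e2) ∧
  (((c1 ≡ᵇ c2) ∧ not (r1 ≡ᵇ r2)) ∨
   ((c2 ≡ᵇ suc c1) ∧ (r2 <ᵇ r1)) ∨
   ((c1 ≡ᵇ suc c2) ∧ (r1 <ᵇ r2)))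

Entries : (n : ℕ) → Vec ℕ n → Filling → Set
Entries n a T = ∀ r c → Box n a r c → 1 ≤ T r c × T r c ≤ n

NonAttacking : (n : ℕ) → Vec ℕ n → Filling → Set
NonAttacking n a T = ∀ r1 c1 r2 c2 → Cell n a r1 c1 → Cell n a r2 c2 →
  attackB r1 c1 (ent T r1 c1) r2 c2 (ent T r2 c2) ≡ false

NoCoInvI : (n : ℕ) → Vec ℕ n → Filling → Set
NoCoInvI n a T = ∀ r c s →
  Cell n a r c → Cell n a r (suc c) → Cell n a s c →
  r < s → row a s < row a r →
  coinvB (ent T r c) c (ent T r (suc c)) (suc c) (ent T s c) c ≡ false

NoCoInvII : (n : ℕ) → Vec ℕ n → Filling → Set
NoCoInvII n a T = ∀ r c s →
  Cell n a r c → Cell n a r (suc c) → Cell n a s (suc c) →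
  s < r → row a s ≤ row a r →
  coinvB (ent T r c) c (ent T r (suc c)) (suc c) (ent T s (suc c)) (suc c) ≡ false

SSKD : (n : ℕ) → Vec ℕ n → Filling → Set
SSKD n a T = Entries n a T × NonAttacking n a T × NoCoInvI n a T × NoCoInvII n a T

module _ (n i : ℕ) (a : Vec ℕ n) (T : Filling) where
  private
    y x : ℕ → ℕ
    y k = ent T (i + 1) k
    x k = ent T i k

  -- flagI k = true  iff in column k of E_i(T) the entry y_k is in row i+1
  flagI : ℕ → Bool
  flagI zero    = true
  flagI (suc k) = if flagI k
    then not (coinvB (y k) k (y (suc k)) (suc k) (x (suc k)) (suc k))
    else coinvB (x k) k (x (suc k)) (suc k) (y (suc k)) (suc k)

  Ei : Filling
  Ei r c =
    if r ≡ᵇ i + 1 then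
      (if c ≤ᵇ row a (i + 1)
        then (if flagI c then y c else x c)
        else T i c)
    else if r ≡ᵇ i then (if flagI c then x c else y c)
    else T r c

module _ (n : ℕ) (a : Vec ℕ n) (T : Filling) where
  private
    y x : ℕ → ℕ
    y k = ent T n k
    x k = ent T 1 k

    bad3 : ℕ → ℕ → ℕ → ℕ → Bool
    bad3 k α β γ =
      coinvB α k β (suc k) γ k ∨
      attackB 1 k α 1 (suc k) β ∨
      attackB 1 k α n k γ ∨
      attackB 1 (suc k) β n k γ

  -- flag0 k = true iff row 1, column k of E_0(T) contains x_k
  -- (otherwise it contains y_{k-1});  meaningful for 1 ≤ k ≤ a_1
  flag0 : ℕ → Bool
  flag0 zero          = true
  flag0 (suc zero)    = true
  flag0 (suc (suc k)) = if flag0 (suc k)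
    then (if bad3 (suc k) (x (suc k)) (x (suc (suc k))) (y (suc k)) then false else true)
    else (if bad3 (suc k) (y k) (y (suc k)) (x (suc (suc k))) then true else false)

  E0 : Filling
  E0 r c =
    if r ≡ᵇ 1 then
      (if c ≤ᵇ row a 1
        then (if flag0 c then x c else y (c ∸ 1))
        else y (c ∸ 1))
    else if r ≡ᵇ n then (if flag0 (suc c) then y c else x (suc c))
    else T r c

E : (n i : ℕ) → Vec ℕ n → Filling → Filling
E n zero    a T = E0 n a T
E n (suc j) a T = Ei n (suc j) a T

Cond : (n i : ℕ) → Vec ℕ n → Set
Cond n zero    a = row a 1 ≤ row a n × 0 < row a 1
Cond n (suc j) a = row a (suc j + 1) < row a (suc j)

module Submission where

-- E_i only rearranges, column by column, the entries of two rows (i and i+1, or 1 and n) and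
-- copies the others, so a condition of SSKD can only fail at cells meeting those two rows. Each
-- such condition becomes a statement about the relative order of at most seven entries and the
-- flags recording the choices of E_i, with the hypotheses supplied by the conditions on T; it
-- depends only on the order type of the entries and is decided by enumerating order types. For
-- a third row whose length lies between those of the two moved rows, the flags are controlled by
-- an invariant proved column by column: while the flag is set, the entry of that row and the
-- two moved entries are cyclically ordered.

open import Defs
open import Data.Nat
  using (ℕ; zero; suc; _+_; _∸_; _<_; _≤_; _<ᵇ_; _≡ᵇ_; _≤ᵇ_; z≤n; s≤s; _≟_; pred)
open import Data.Nat.Properties
  using (<-cmp; ≤-refl; ≤-trans; <-trans; <⇒≤; <-irrefl; <⇒≢; >⇒≢; ≤-antisym; +-comm; +-mono-≤; +-suc;
         _<?_; _≤?_; ≰⇒>; ≮⇒≥; <⇒≱; ≤-pred; m∸n≤m; m≤n⇒m<n∨m≡n)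
open import Data.Bool using (Bool; true; false; _∧_; _∨_; not; if_then_else_)
open import Data.Bool.Properties using (∨-zeroʳ; ∨-comm; ∧-zeroʳ)
open import Data.Fin using (toℕ; #_)
open import Data.Vec using (Vec; []; _∷_; lookup; map; tabulate)
open import Data.Vec.Properties using (lookup-map)
open import Data.List using (List; []; _∷_)
open import Data.Product using (_×_; _,_; proj₁; proj₂; Σ-syntax)
open import Data.Sum using (_⊎_; inj₁; inj₂)
open import Data.Unit using (⊤; tt)
open import Data.Empty using (⊥; ⊥-elim)
open import Relation.Nullary using (Dec; yes; no)
open import Relation.Binary using (tri<; tri≈; tri>)
open import Relation.Binary.PropositionalEquality
  using (_≡_; _≢_; ≢-sym; refl; sym; trans; cong; cong₂; subst; subst₂)

<ᵇ-true : ∀ {m n} → m < n → (m <ᵇ n) ≡ true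
<ᵇ-true {zero}  {suc n} _       = refl
<ᵇ-true {suc m} {suc n} (s≤s p) = <ᵇ-true p

<ᵇ-false : ∀ {m n} → n ≤ m → (m <ᵇ n) ≡ false
<ᵇ-false {m}     {zero}  _       = refl
<ᵇ-false {suc m} {suc n} (s≤s p) = <ᵇ-false p

≡ᵇ-true : ∀ {m n} → m ≡ n → (m ≡ᵇ n) ≡ true
≡ᵇ-true {zero}  refl = refl
≡ᵇ-true {suc m} refl = ≡ᵇ-true {m} refl

≡ᵇ-false : ∀ {m n} → m ≢ n → (m ≡ᵇ n) ≡ false
≡ᵇ-false {zero}  {zero}  m≢n = ⊥-elim (m≢n refl)
≡ᵇ-false {zero}  {suc n} m≢n = refl
≡ᵇ-false {suc m} {zero}  m≢n = refl
≡ᵇ-false {suc m} {suc n} m≢n = ≡ᵇ-false (λ m≡n → m≢n (cong suc m≡n))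

≤ᵇ-true : ∀ {c m} → c ≤ m → (c ≤ᵇ m) ≡ true
≤ᵇ-true {zero}  _   = refl
≤ᵇ-true {suc c} c≤m = <ᵇ-true c≤m

≤ᵇ-false : ∀ {c m} → m < c → (c ≤ᵇ m) ≡ false
≤ᵇ-false {suc c} (s≤s m≤c) = <ᵇ-false m≤c

≡ᵇ-false⇒≢ : ∀ {m n} → (m ≡ᵇ n) ≡ false → m ≢ n
≡ᵇ-false⇒≢ {zero}  () refl
≡ᵇ-false⇒≢ {suc m} e  refl = ≡ᵇ-false⇒≢ {m} e refl

≡ᵇ-true⇒≡ : ∀ {m n} → (m ≡ᵇ n) ≡ true → m ≡ n
≡ᵇ-true⇒≡ {zero}  {zero}  _ = refl
≡ᵇ-true⇒≡ {suc m} {suc n} e = cong suc (≡ᵇ-true⇒≡ e)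

<ᵇ-true⇒< : ∀ {m n} → (m <ᵇ n) ≡ true → m < n
<ᵇ-true⇒< {zero}  {suc n} _ = s≤s z≤n
<ᵇ-true⇒< {suc m} {suc n} e = s≤s (<ᵇ-true⇒< e)

≡ᵇ-sym : ∀ m n → (m ≡ᵇ n) ≡ (n ≡ᵇ m)
≡ᵇ-sym zero    zero    = refl
≡ᵇ-sym zero    (suc n) = refl
≡ᵇ-sym (suc m) zero    = refl
≡ᵇ-sym (suc m) (suc n) = ≡ᵇ-sym m n

≢ᵇ-sym : ∀ m n → (m ≡ᵇ n) ≡ false → (n ≡ᵇ m) ≡ false
≢ᵇ-sym m n m≢n = trans (≡ᵇ-sym n m) m≢n

if-then : ∀ {A : Set} {c : Bool} {p q : A} → c ≡ true → (if c then p else q) ≡ p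
if-then refl = refl

if-else : ∀ {A : Set} {c : Bool} {p q : A} → c ≡ false → (if c then p else q) ≡ q
if-else refl = refl

if-both : ∀ {A : Set} (P : A → Set) (c : Bool) {p q : A} → P p → P q → P (if c then p else q)
if-both P true  p q = p
if-both P false p q = q

if-false-true : ∀ c → (if c then false else true) ≡ not c
if-false-true true  = refl
if-false-true false = refl

if-true-false : ∀ c → (if c then true else false) ≡ c
if-true-false true  = refl
if-true-false false = refl

if-swap-distinct : ∀ (c : Bool) {p q} → (p ≡ᵇ q) ≡ false →
  ((if c then p else q) ≡ᵇ (if c then q else p)) ≡ false
if-swap-distinct true          p≢q = p≢q
if-swap-distinct false {p} {q} p≢q = trans (≡ᵇ-sym q p) p≢q

∧-true-left : ∀ {a c} → a ∧ c ≡ true → a ≡ true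
∧-true-left {true} _ = refl

∧-true-right : ∀ {a c} → a ∧ c ≡ true → c ≡ true
∧-true-right {true} h = h

∧-false : ∀ {a c} → (a ≡ true → c ≡ true → false ≡ true) → a ∧ c ≡ false
∧-false {true}  {true}  h = sym (h refl refl)
∧-false {true}  {false} h = refl
∧-false {false}         h = refl

not-true : ∀ {a} → not a ≡ true → a ≡ false
not-true {false} _ = refl

module OrderTypes where

  open import Data.Fin using (Fin; zero; suc)

  data Term (k b : ℕ) : Set where
    var : Fin k → Term k b
    ite : Fin b → Term k b → Term k b → Term k b

  data Formula (k b : ℕ) : Set where
    lt        : Term k b → ℕ → Term k b → ℕ → Formula k b
    eq        : Term k b → Term k b → Formula k b
    flag      : Fin b → Formula k b
    ⊤f ⊥f     : Formula k b
    _∧f_ _∨f_ : Formula k b → Formula k b → Formula k b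
    ¬f        : Formula k b → Formula k b
    iteF      : Formula k b → Formula k b → Formula k b → Formula k b

  infixr 6 _∧f_
  infixr 5 _∨f_

  _⇒f_ : ∀ {k b} → Formula k b → Formula k b → Formula k b
  φ ⇒f ψ = iteF φ ψ ⊤f

  infixr 4 _⇒f_

  coinvF : ∀ {k b} → Term k b → ℕ → Term k b → ℕ → Term k b → ℕ → Formula k b
  coinvF α cα β cβ γ cγ =
    (lt α cα β cβ ∧f lt β cβ γ cγ) ∨f (lt β cβ γ cγ ∧f lt γ cγ α cα) ∨f (lt γ cγ α cα ∧f lt α cα β cβ)

  ⟦_⟧ᵗ : ∀ {k b} → Term k b → Vec ℕ k → Vec Bool b → ℕ
  ⟦ var i     ⟧ᵗ v fs = lookup v i
  ⟦ ite f s t ⟧ᵗ v fs = if lookup fs f then ⟦ s ⟧ᵗ v fs else ⟦ t ⟧ᵗ v fs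

  ⟦_⟧ : ∀ {k b} → Formula k b → Vec ℕ k → Vec Bool b → Bool
  ⟦ lt s c t d   ⟧ v fs = ltB (⟦ s ⟧ᵗ v fs) c (⟦ t ⟧ᵗ v fs) d
  ⟦ eq s t       ⟧ v fs = ⟦ s ⟧ᵗ v fs ≡ᵇ ⟦ t ⟧ᵗ v fs
  ⟦ flag f       ⟧ v fs = lookup fs f
  ⟦ ⊤f           ⟧ v fs = true
  ⟦ ⊥f           ⟧ v fs = false
  ⟦ φ ∧f ψ       ⟧ v fs = ⟦ φ ⟧ v fs ∧ ⟦ ψ ⟧ v fs
  ⟦ φ ∨f ψ       ⟧ v fs = ⟦ φ ⟧ v fs ∨ ⟦ ψ ⟧ v fs
  ⟦ ¬f φ         ⟧ v fs = not (⟦ φ ⟧ v fs)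
  ⟦ iteF φ ψ χ   ⟧ v fs = if ⟦ φ ⟧ v fs then ⟦ ψ ⟧ v fs else ⟦ χ ⟧ v fs

  term-selects-entry : ∀ {k b} (t : Term k b) (fs : Vec Bool b) →
    Σ[ i ∈ Fin k ] (∀ v → ⟦ t ⟧ᵗ v fs ≡ lookup v i)
  term-selects-entry (var i)     fs = i , λ v → refl
  term-selects-entry (ite f s t) fs with lookup fs f
  ... | true  = term-selects-entry s fs
  ... | false = term-selects-entry t fs

  -- Formulas only compare entries, so their value depends on the order type of v alone.

  PreservesOrderOn : ∀ {k} → (ℕ → ℕ) → Vec ℕ k → Set
  PreservesOrderOn {k} g v = ∀ (i j : Fin k) →
    ((lookup v i <ᵇ lookup v j) ≡ (g (lookup v i) <ᵇ g (lookup v j))) ×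
    ((lookup v i ≡ᵇ lookup v j) ≡ (g (lookup v i) ≡ᵇ g (lookup v j)))

  ⟦⟧-invariant : ∀ {k b} (φ : Formula k b) g v fs → PreservesOrderOn g v →
    ⟦ φ ⟧ v fs ≡ ⟦ φ ⟧ (map g v) fs
  ⟦⟧-invariant (lt s c t d) g v fs pres
    with term-selects-entry s fs | term-selects-entry t fs
  ... | i , sᵢ | j , tⱼ
    rewrite sᵢ v | tⱼ v | sᵢ (map g v) | tⱼ (map g v) | lookup-map i g v | lookup-map j g v
    with pres i j
  ... | <-same , ≡-same rewrite <-same | ≡-same = refl
  ⟦⟧-invariant (eq s t) g v fs pres
    with term-selects-entry s fs | term-selects-entry t fs
  ... | i , sᵢ | j , tⱼ
    rewrite sᵢ v | tⱼ v | sᵢ (map g v) | tⱼ (map g v) | lookup-map i g v | lookup-map j g v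
    = proj₂ (pres i j)
  ⟦⟧-invariant (flag f)     g v fs pres = refl
  ⟦⟧-invariant ⊤f           g v fs pres = refl
  ⟦⟧-invariant ⊥f           g v fs pres = refl
  ⟦⟧-invariant (φ ∧f ψ)     g v fs pres =
    cong₂ _∧_ (⟦⟧-invariant φ g v fs pres) (⟦⟧-invariant ψ g v fs pres)
  ⟦⟧-invariant (φ ∨f ψ)     g v fs pres =
    cong₂ _∨_ (⟦⟧-invariant φ g v fs pres) (⟦⟧-invariant ψ g v fs pres)
  ⟦⟧-invariant (¬f φ)       g v fs pres = cong not (⟦⟧-invariant φ g v fs pres)
  ⟦⟧-invariant (iteF φ ψ χ) g v fs pres
    rewrite ⟦⟧-invariant φ g v fs pres | ⟦⟧-invariant ψ g v fs pres | ⟦⟧-invariant χ g v fs pres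
    = refl

  rank : ∀ {k} → Vec ℕ k → ℕ → ℕ
  rank []       x = 0
  rank (u ∷ us) x = (if u <ᵇ x then 1 else 0) + rank us x

  below-mono : ∀ u {x y} → x ≤ y → (if u <ᵇ x then 1 else 0) ≤ (if u <ᵇ y then 1 else 0)
  below-mono u {x} {y} x≤y with u <ᵇ x in ux | u <ᵇ y in uy
  ... | false | _     = z≤n
  ... | true  | true  = ≤-refl
  ... | true  | false = ⊥-elim (lemma u x y x≤y ux uy)
    where
    lemma : ∀ u x y → x ≤ y → (u <ᵇ x) ≡ true → (u <ᵇ y) ≡ false → ⊥
    lemma zero    (suc x) (suc y) _         _  ()
    lemma (suc u) (suc x) (suc y) (s≤s x≤y) ux uy = lemma u x y x≤y ux uy
    lemma zero    zero    _       _         () _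
    lemma (suc u) zero    _       _         () _

  below-≤1 : ∀ u x → (if u <ᵇ x then 1 else 0) ≤ 1
  below-≤1 u x with u <ᵇ x
  ... | true  = ≤-refl
  ... | false = z≤n

  rank-mono : ∀ {k} (v : Vec ℕ k) {x y} → x ≤ y → rank v x ≤ rank v y
  rank-mono []       x≤y = z≤n
  rank-mono (u ∷ us) x≤y = +-mono-≤ (below-mono u x≤y) (rank-mono us x≤y)

  rank-≤ : ∀ {k} (v : Vec ℕ k) x → rank v x ≤ k
  rank-≤ []       x = z≤n
  rank-≤ (u ∷ us) x = +-mono-≤ (below-≤1 u x) (rank-≤ us x)

  suc-+-≤ : ∀ {a b c d} → a ≤ c → suc b ≤ d → suc (a + b) ≤ c + d
  suc-+-≤ {a} {b} {c} {d} a≤c b<d = subst (_≤ c + d) (+-suc a b) (+-mono-≤ a≤c b<d)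

  rank-strict : ∀ {k} (v : Vec ℕ k) i {y} → lookup v i < y → rank v (lookup v i) < rank v y
  rank-strict (u ∷ us) zero {y} u<y
    rewrite <ᵇ-false (≤-refl {u}) | <ᵇ-true u<y = s≤s (rank-mono us (<⇒≤ u<y))
  rank-strict (u ∷ us) (suc i) x<y =
    suc-+-≤ (below-mono u (<⇒≤ x<y)) (rank-strict us i x<y)

  rank-< : ∀ {k} (v : Vec ℕ k) i → rank v (lookup v i) < k
  rank-< (u ∷ us) zero rewrite <ᵇ-false (≤-refl {u}) = s≤s (rank-≤ us u)
  rank-< (u ∷ us) (suc i) = suc-+-≤ (below-≤1 u (lookup us i)) (rank-< us i)

  rank-preserves-order : ∀ {k} (v : Vec ℕ k) → PreservesOrderOn (rank v) v
  rank-preserves-order v i j with <-cmp (lookup v i) (lookup v j)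
  ... | tri< vᵢ<vⱼ _ _ =
    trans (<ᵇ-true vᵢ<vⱼ) (sym (<ᵇ-true (rank-strict v i vᵢ<vⱼ))) ,
    trans (≡ᵇ-false (<⇒≢ vᵢ<vⱼ)) (sym (≡ᵇ-false (<⇒≢ (rank-strict v i vᵢ<vⱼ))))
  ... | tri≈ _ vᵢ≡vⱼ _ rewrite vᵢ≡vⱼ =
    trans (<ᵇ-false (≤-refl {lookup v j})) (sym (<ᵇ-false (≤-refl {rank v (lookup v j)}))) ,
    trans (≡ᵇ-true {lookup v j} refl) (sym (≡ᵇ-true {rank v (lookup v j)} refl))
  ... | tri> _ _ vⱼ<vᵢ =
    trans (<ᵇ-false (<⇒≤ vⱼ<vᵢ)) (sym (<ᵇ-false (<⇒≤ (rank-strict v j vⱼ<vᵢ)))) ,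
    trans (≡ᵇ-false (>⇒≢ vⱼ<vᵢ)) (sym (≡ᵇ-false (>⇒≢ (rank-strict v j vⱼ<vᵢ))))

  rank-entry-< : ∀ {k} (v : Vec ℕ k) i → lookup (map (rank v) v) i < k
  rank-entry-< v i = subst (_< _) (sym (lookup-map i (rank v) v)) (rank-< v i)

  -- Equations between formulas, and hypotheses arranged in layers: the layer
  -- in front of Layers b k mentions the first of the k variables and possibly
  -- the later ones, so it can be tested as soon as that variable is chosen.

  data Equation (k b : ℕ) : Set where
    _≐_ : Formula k b → Formula k b → Equation k b

  infix 3 _≐_

  Holds : ∀ {k b} → Equation k b → Vec ℕ k → Vec Bool b → Set
  Holds (φ ≐ ψ) v fs = ⟦ φ ⟧ v fs ≡ ⟦ ψ ⟧ v fs

  holdsᵇ : ∀ {k b} → Equation k b → Vec ℕ k → Vec Bool b → Bool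
  holdsᵇ (φ ≐ ψ) v fs = if ⟦ φ ⟧ v fs then ⟦ ψ ⟧ v fs else not (⟦ ψ ⟧ v fs)

  holdsᵇ-sound : ∀ {k b} (e : Equation k b) v fs → holdsᵇ e v fs ≡ true → Holds e v fs
  holdsᵇ-sound (φ ≐ ψ) v fs h with ⟦ φ ⟧ v fs | ⟦ ψ ⟧ v fs
  holdsᵇ-sound (φ ≐ ψ) v fs _  | true  | true  = refl
  holdsᵇ-sound (φ ≐ ψ) v fs _  | false | false = refl
  holdsᵇ-sound (φ ≐ ψ) v fs () | true  | false
  holdsᵇ-sound (φ ≐ ψ) v fs () | false | true

  holdsᵇ-complete : ∀ {k b} (e : Equation k b) v fs → Holds e v fs → holdsᵇ e v fs ≡ true
  holdsᵇ-complete (φ ≐ ψ) v fs h rewrite h with ⟦ ψ ⟧ v fs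
  ... | true  = refl
  ... | false = refl

  HoldsAll : ∀ {k b} → List (Equation k b) → Vec ℕ k → Vec Bool b → Set
  HoldsAll []       v fs = ⊤
  HoldsAll (e ∷ es) v fs = Holds e v fs × HoldsAll es v fs

  holdsAllᵇ : ∀ {k b} → List (Equation k b) → Vec ℕ k → Vec Bool b → Bool
  holdsAllᵇ []       v fs = true
  holdsAllᵇ (e ∷ es) v fs = holdsᵇ e v fs ∧ holdsAllᵇ es v fs

  holdsAllᵇ-complete : ∀ {k b} (es : List (Equation k b)) v fs →
    HoldsAll es v fs → holdsAllᵇ es v fs ≡ true
  holdsAllᵇ-complete []       v fs _        = refl
  holdsAllᵇ-complete (e ∷ es) v fs (h , hs)
    rewrite holdsᵇ-complete e v fs h = holdsAllᵇ-complete es v fs hs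

  HoldsAll-invariant : ∀ {k b} (es : List (Equation k b)) g v fs → PreservesOrderOn g v →
    HoldsAll es v fs → HoldsAll es (map g v) fs
  HoldsAll-invariant []             g v fs pres _        = tt
  HoldsAll-invariant ((φ ≐ ψ) ∷ es) g v fs pres (h , hs) =
    trans (sym (⟦⟧-invariant φ g v fs pres)) (trans h (⟦⟧-invariant ψ g v fs pres)) ,
    HoldsAll-invariant es g v fs pres hs

  data Layers (b : ℕ) : ℕ → Set where
    []  : Layers b zero
    _∷_ : ∀ {k} → List (Equation (suc k) b) → Layers b k → Layers b (suc k)

  Satisfies : ∀ {k b} → Layers b k → Vec ℕ k → Vec Bool b → Set
  Satisfies []       []      fs = ⊤
  Satisfies (l ∷ ls) (x ∷ v) fs = HoldsAll l (x ∷ v) fs × Satisfies ls v fs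

  Satisfies-invariant : ∀ {k b} (ls : Layers b k) g v fs → PreservesOrderOn g v →
    Satisfies ls v fs → Satisfies ls (map g v) fs
  Satisfies-invariant []       g []      fs pres _        = tt
  Satisfies-invariant (l ∷ ls) g (x ∷ v) fs pres (h , hs) =
    HoldsAll-invariant l g (x ∷ v) fs pres h ,
    Satisfies-invariant ls g v fs (λ i j → pres (suc i) (suc j)) hs

  allBelow : ℕ → (ℕ → Bool) → Bool
  allBelow zero    p = true
  allBelow (suc m) p = p m ∧ allBelow m p

  allBelow-sound : ∀ m p x → x < m → allBelow m p ≡ true → p x ≡ true
  allBelow-sound (suc m) p x x<m h with m≤n⇒m<n∨m≡n x<m
  ... | inj₂ refl       = ∧-true-left h
  ... | inj₁ (s≤s x<m′) = allBelow-sound m p x x<m′ (∧-true-right {p m} h)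

  allFlags : (b : ℕ) → (Vec Bool b → Bool) → Bool
  allFlags zero    p = p []
  allFlags (suc b) p = allFlags b (λ fs → p (true ∷ fs)) ∧ allFlags b (λ fs → p (false ∷ fs))

  allFlags-sound : ∀ b p (fs : Vec Bool b) → allFlags b p ≡ true → p fs ≡ true
  allFlags-sound zero    p []           h = h
  allFlags-sound (suc b) p (true ∷ fs)  h = allFlags-sound b _ fs (∧-true-left h)
  allFlags-sound (suc b) p (false ∷ fs) h =
    allFlags-sound b _ fs (∧-true-right {allFlags b (λ fs → p (true ∷ fs))} h)

  search : ∀ {k b} → ℕ → Layers b k → Vec Bool b → (Vec ℕ k → Bool) → Bool
  search bound []       fs p = p []
  search bound (l ∷ ls) fs p =
    search bound ls fs (λ v → allBelow bound (λ x → if holdsAllᵇ l (x ∷ v) fs then p (x ∷ v) else true))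

  search-sound : ∀ {k b} bound (ls : Layers b k) fs p v → (∀ i → lookup v i < bound) →
    Satisfies ls v fs → search bound ls fs p ≡ true → p v ≡ true
  search-sound bound []       fs p []      _     _        h = h
  search-sound bound (l ∷ ls) fs p (x ∷ v) bound-v (hl , hs) h =
    subst (λ c → (if c then p (x ∷ v) else true) ≡ true) (holdsAllᵇ-complete l (x ∷ v) fs hl)
      (allBelow-sound bound _ x (bound-v zero)
        (search-sound bound ls fs _ v (λ i → bound-v (suc i)) hs h))

  -- A layered implication between order formulas holds for all entries as soon
  -- as it holds for all vectors with entries below k, since ranks preserve it.

  by-order-type : ∀ {k b} (ls : Layers b k) (goal : Equation k b) →
    allFlags b (λ fs → search k ls fs (λ v → holdsᵇ goal v fs)) ≡ true →
    ∀ v fs → Satisfies ls v fs → Holds goal v fs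
  by-order-type {k} {b} ls (φ ≐ ψ) checked v fs hyps =
    trans (⟦⟧-invariant φ (rank v) v fs pres)
      (trans (holdsᵇ-sound (φ ≐ ψ) (map (rank v) v) fs on-ranks)
        (sym (⟦⟧-invariant ψ (rank v) v fs pres)))
    where
    pres = rank-preserves-order v
    on-ranks = search-sound k ls fs _ (map (rank v) v) (rank-entry-< v)
      (Satisfies-invariant ls (rank v) v fs pres hyps)
      (allFlags-sound b _ fs checked)

  v₀ : ∀ {k b} → Term (suc k) b
  v₀ = var zero

  v₁ : ∀ {k b} → Term (suc (suc k)) b
  v₁ = var (suc zero)

  v₂ : ∀ {k b} → Term (suc (suc (suc k))) b
  v₂ = var (suc (suc zero))

  v₃ : ∀ {k b} → Term (suc (suc (suc (suc k)))) b
  v₃ = var (suc (suc (suc zero)))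

  v₄ : ∀ {k b} → Term (suc (suc (suc (suc (suc k))))) b
  v₄ = var (suc (suc (suc (suc zero))))

  v₅ : ∀ {k b} → Term (suc (suc (suc (suc (suc (suc k)))))) b
  v₅ = var (suc (suc (suc (suc (suc zero)))))

  v₆ : ∀ {k b} → Term (suc (suc (suc (suc (suc (suc (suc k))))))) b
  v₆ = var (suc (suc (suc (suc (suc (suc zero))))))

module Predicates where

  ltB-same-column : ∀ {e₁ e₂} → e₁ < e₂ → ltB e₁ 0 e₂ 0 ≡ true
  ltB-same-column e₁<e₂ rewrite <ᵇ-true e₁<e₂ = refl

  ltB-right-column : ∀ {e₁ e₂} → e₁ ≤ e₂ → ltB e₁ 1 e₂ 0 ≡ true
  ltB-right-column {zero}   {zero}   _ = refl
  ltB-right-column {zero}   {suc e₂} _ = refl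
  ltB-right-column {suc e₁} {suc e₂} (s≤s e₁≤e₂) = ltB-right-column {e₁} {e₂} e₁≤e₂

  -- ltB compares columns with _<ᵇ_, which reduces along suc.

  coinvI-columns : ∀ c α β γ → coinvB α c β (suc c) γ c ≡ coinvB α 0 β 1 γ 0
  coinvI-columns zero    α β γ = refl
  coinvI-columns (suc c) α β γ = coinvI-columns c α β γ

  coinvII-columns : ∀ c α β γ → coinvB α c β (suc c) γ (suc c) ≡ coinvB α 0 β 1 γ 1
  coinvII-columns zero    α β γ = refl
  coinvII-columns (suc c) α β γ = coinvII-columns c α β γ

  coinvB-cong : ∀ {α α′ β β′ γ γ′} cα cβ cγ → α ≡ α′ → β ≡ β′ → γ ≡ γ′ →
    coinvB α cα β cβ γ cγ ≡ coinvB α′ cα β′ cβ γ′ cγ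
  coinvB-cong cα cβ cγ refl refl refl = refl

  attackB-same-column : ∀ r₁ r₂ c e₁ e₂ → r₁ ≢ r₂ → attackB r₁ c e₁ r₂ c e₂ ≡ (e₁ ≡ᵇ e₂)
  attackB-same-column r₁ r₂ c e₁ e₂ r₁≢r₂
    rewrite ≡ᵇ-true {c} refl | ≡ᵇ-false r₁≢r₂ with e₁ ≡ᵇ e₂
  ... | true  = refl
  ... | false = refl

  attackB-next-column : ∀ r₁ r₂ c e₁ e₂ → r₂ < r₁ → attackB r₁ c e₁ r₂ (suc c) e₂ ≡ (e₁ ≡ᵇ e₂)
  attackB-next-column r₁ r₂ c e₁ e₂ r₂<r₁
    rewrite ≡ᵇ-true {c} refl | <ᵇ-true r₂<r₁ with e₁ ≡ᵇ e₂
  ... | false = refl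
  ... | true  = ∨-zeroʳ _

  attackB-same-row : ∀ r c₁ e₁ c₂ e₂ → attackB r c₁ e₁ r c₂ e₂ ≡ false
  attackB-same-row r c₁ e₁ c₂ e₂ rewrite ≡ᵇ-true {r} refl | <ᵇ-false (≤-refl {r}) with e₁ ≡ᵇ e₂
  ... | false = refl
  ... | true
    rewrite ∧-zeroʳ (c₁ ≡ᵇ c₂) | ∧-zeroʳ (c₂ ≡ᵇ suc c₁) | ∧-zeroʳ (c₁ ≡ᵇ suc c₂) = refl

  attackB-sym : ∀ r₁ c₁ e₁ r₂ c₂ e₂ → attackB r₁ c₁ e₁ r₂ c₂ e₂ ≡ attackB r₂ c₂ e₂ r₁ c₁ e₁
  attackB-sym r₁ c₁ e₁ r₂ c₂ e₂ rewrite ≡ᵇ-sym e₁ e₂ | ≡ᵇ-sym c₁ c₂ | ≡ᵇ-sym r₁ r₂ with e₂ ≡ᵇ e₁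
  ... | false = refl
  ... | true  =
    cong ((c₂ ≡ᵇ c₁) ∧ not (r₂ ≡ᵇ r₁) ∨_) (∨-comm ((c₂ ≡ᵇ suc c₁) ∧ (r₂ <ᵇ r₁)) ((c₁ ≡ᵇ suc c₂) ∧ (r₁ <ᵇ r₂)))

  attackB-next-column′ : ∀ r₁ r₂ c e₁ e₂ → r₁ < r₂ → attackB r₁ (suc c) e₁ r₂ c e₂ ≡ (e₁ ≡ᵇ e₂)
  attackB-next-column′ r₁ r₂ c e₁ e₂ r₁<r₂ =
    trans (attackB-sym r₁ (suc c) e₁ r₂ c e₂)
      (trans (attackB-next-column r₂ r₁ c e₂ e₁ r₁<r₂) (≡ᵇ-sym e₂ e₁))

  attackB-rows : ∀ r₁ r₂ r₁′ r₂′ c₁ e₁ c₂ e₂ →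
    (r₁ ≡ᵇ r₂) ≡ (r₁′ ≡ᵇ r₂′) → (r₂ <ᵇ r₁) ≡ (r₂′ <ᵇ r₁′) → (r₁ <ᵇ r₂) ≡ (r₁′ <ᵇ r₂′) →
    attackB r₁ c₁ e₁ r₂ c₂ e₂ ≡ attackB r₁′ c₁ e₁ r₂′ c₂ e₂
  attackB-rows r₁ r₂ r₁′ r₂′ c₁ e₁ c₂ e₂ p q s rewrite p | q | s = refl

  attackB-false : ∀ r₁ c₁ e₁ r₂ c₂ e₂ →
    (c₁ ≡ c₂ → r₁ ≢ r₂ → (e₁ ≡ᵇ e₂) ≡ false) →
    (c₂ ≡ suc c₁ → r₂ < r₁ → (e₁ ≡ᵇ e₂) ≡ false) →
    (c₁ ≡ suc c₂ → r₁ < r₂ → (e₁ ≡ᵇ e₂) ≡ false) →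
    attackB r₁ c₁ e₁ r₂ c₂ e₂ ≡ false
  attackB-false r₁ c₁ e₁ r₂ c₂ e₂ same next prev with e₁ ≡ᵇ e₂
  ... | false = refl
  ... | true  =
    cong₂ _∨_ (∧-false λ c r → sym (same (≡ᵇ-true⇒≡ c) (≡ᵇ-false⇒≢ (not-true r))))
      (cong₂ _∨_ (∧-false λ c r → sym (next (≡ᵇ-true⇒≡ c) (<ᵇ-true⇒< r)))
                 (∧-false λ c r → sym (prev (≡ᵇ-true⇒≡ c) (<ᵇ-true⇒< r))))

  row-tabulate : ∀ n (F : ℕ → ℕ) R → 1 ≤ R → R ≤ n →
    row (tabulate {n = n} (λ k → F (suc (toℕ k)))) R ≡ F R
  row-tabulate (suc n) F (suc zero)    _ _         = refl
  row-tabulate (suc n) F (suc (suc r)) _ (s≤s R≤n) = row-tabulate n (λ z → F (suc z)) (suc r) (s≤s z≤n) R≤n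

-- In the next two modules x, y (x1, y1) are the entries of the two rows moved by the operator in
-- one column (the next one), y₋ that of the second row in the previous column, A, A1 those of a
-- third row, b₁, bₙ, r, i, j, R basement entries and f, f1 the flags of the operator; columns are
-- normalised to 0 and 1 as in coinvI-columns and coinvII-columns.

module EiPatterns where

  open OrderTypes

  nextFlagI : Bool → ℕ → ℕ → ℕ → ℕ → Bool
  nextFlagI f x y x′ y′ = if f then not (coinvB y 0 y′ 1 x′ 1) else coinvB x 0 x′ 1 y′ 1

  nextFlagIF : ∀ {k b} → Term k (suc b) → Term k (suc b) → Term k (suc b) → Term k (suc b) → Formula k (suc b)
  nextFlagIF x y x′ y′ = iteF (flag (# 0)) (¬f (coinvF y 0 y′ 1 x′ 1)) (coinvF x 0 x′ 1 y′ 1)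

  cyclic-start-below : ∀ (r i j : ℕ)
    → ltB r 0 i 0 ≡ true
    → ltB i 0 j 0 ≡ true
    → coinvB r 0 i 0 j 0 ≡ true
  cyclic-start-below r i j h0 h1 =
    by-order-type
      ( ((lt v₂ 0 v₀ 0 ≐ ⊤f) ∷ [])
      ∷ ((lt v₀ 0 v₁ 0 ≐ ⊤f) ∷ [])
      ∷ []
      ∷ [])
      (coinvF v₁ 0 v₂ 0 v₀ 0 ≐ ⊤f)
      refl (j ∷ r ∷ i ∷ []) []
      ((h1 , tt) , ((h0 , tt) , (tt , tt)))

  cyclic-start-above : ∀ (r i j : ℕ)
    → ltB j 0 r 0 ≡ true
    → ltB i 0 j 0 ≡ true
    → coinvB r 0 i 0 j 0 ≡ true
  cyclic-start-above r i j h0 h1 =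
    by-order-type
      ( ((lt v₀ 0 v₂ 0 ≐ ⊤f) ∷ [])
      ∷ ((lt v₁ 0 v₀ 0 ≐ ⊤f) ∷ [])
      ∷ []
      ∷ [])
      (coinvF v₁ 0 v₀ 0 v₂ 0 ≐ ⊤f)
      refl (i ∷ r ∷ j ∷ []) []
      ((h1 , tt) , ((h0 , tt) , (tt , tt)))

  cyclic-step-below : ∀ (x y x1 y1 A A1 : ℕ) (f f1 : Bool)
    → f1 ≡ nextFlagI f x y x1 y1
    → (x1 ≡ᵇ y1) ≡ false
    → (A1 ≡ᵇ x1) ≡ false
    → coinvB x 0 x1 1 A1 1 ≡ false
    → coinvB A 0 A1 1 y 0 ≡ false
    → (if f then coinvB A 0 x 0 y 0 else true) ≡ true
    → (if f1 then coinvB A1 0 x1 0 y1 0 else true) ≡ true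
  cyclic-step-below x y x1 y1 A A1 f f1 h0 h1 h2 h3 h4 h5 =
    by-order-type
      ( ((coinvF v₀ 0 v₄ 1 v₁ 0 ≐ ⊥f) ∷ (flag (# 0) ⇒f coinvF v₀ 0 v₃ 0 v₁ 0 ≐ ⊤f) ∷ [])
      ∷ ((flag (# 1) ≐ nextFlagIF v₂ v₀ v₄ v₁) ∷ [])
      ∷ ((eq v₃ v₀ ≐ ⊥f) ∷ [])
      ∷ ((coinvF v₀ 0 v₂ 1 v₁ 1 ≐ ⊥f) ∷ [])
      ∷ ((eq v₀ v₁ ≐ ⊥f) ∷ [])
      ∷ []
      ∷ [])
      (flag (# 1) ⇒f coinvF v₄ 0 v₅ 0 v₂ 0 ≐ ⊤f)
      refl (A ∷ y ∷ y1 ∷ x ∷ A1 ∷ x1 ∷ []) (f ∷ f1 ∷ [])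
      ((h4 , h5 , tt) , ((h0 , tt) , ((h1 , tt) , ((h3 , tt) , ((h2 , tt) , (tt , tt))))))

  cyclic-step-above : ∀ (x y x1 y1 A A1 : ℕ) (f f1 : Bool)
    → f1 ≡ nextFlagI f x y x1 y1
    → (x1 ≡ᵇ y1) ≡ false
    → (A1 ≡ᵇ y1) ≡ false
    → coinvB x 0 x1 1 A 0 ≡ false
    → coinvB A 0 A1 1 y1 1 ≡ false
    → (if f then coinvB A 0 x 0 y 0 else true) ≡ true
    → (if f1 then coinvB A1 0 x1 0 y1 0 else true) ≡ true
  cyclic-step-above x y x1 y1 A A1 f f1 h0 h1 h2 h3 h4 h5 =
    by-order-type
      ( ((flag (# 1) ≐ nextFlagIF v₁ v₀ v₄ v₅) ∷ (flag (# 0) ⇒f coinvF v₂ 0 v₁ 0 v₀ 0 ≐ ⊤f) ∷ [])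
      ∷ ((coinvF v₀ 0 v₃ 1 v₁ 0 ≐ ⊥f) ∷ [])
      ∷ ((coinvF v₀ 0 v₁ 1 v₃ 1 ≐ ⊥f) ∷ [])
      ∷ ((eq v₀ v₂ ≐ ⊥f) ∷ [])
      ∷ ((eq v₀ v₁ ≐ ⊥f) ∷ [])
      ∷ []
      ∷ [])
      (flag (# 1) ⇒f coinvF v₃ 0 v₄ 0 v₅ 0 ≐ ⊤f)
      refl (y ∷ x ∷ A ∷ A1 ∷ x1 ∷ y1 ∷ []) (f ∷ f1 ∷ [])
      ((h0 , h5 , tt) , ((h3 , tt) , ((h4 , tt) , ((h2 , tt) , ((h1 , tt) , (tt , tt))))))

  diagonal-distinct : ∀ (x y x1 y1 : ℕ) (f f1 : Bool)
    → f1 ≡ nextFlagI f x y x1 y1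
    → (x1 ≡ᵇ y1) ≡ false
    → ((if f then y else x) ≡ᵇ (if f1 then x1 else y1)) ≡ false
  diagonal-distinct x y x1 y1 f f1 h0 h1 =
    by-order-type
      ( ((flag (# 1) ≐ nextFlagIF v₁ v₀ v₃ v₂) ∷ [])
      ∷ []
      ∷ ((eq v₁ v₀ ≐ ⊥f) ∷ [])
      ∷ []
      ∷ [])
      (eq (ite (# 0) v₀ v₁) (ite (# 1) v₃ v₂) ≐ ⊥f)
      refl (y ∷ x ∷ y1 ∷ x1 ∷ []) (f ∷ f1 ∷ [])
      ((h0 , tt) , (tt , ((h1 , tt) , (tt , tt))))

  inner-typeII : ∀ (x y x1 y1 : ℕ) (f f1 : Bool)
    → f1 ≡ nextFlagI f x y x1 y1
    → (coinvB (if f then y else x) 0 (if f1 then y1 else x1) 1 (if f1 then x1 else y1) 1) ≡ false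
  inner-typeII x y x1 y1 f f1 h0 =
    by-order-type
      ( ((flag (# 1) ≐ nextFlagIF v₃ v₂ v₁ v₀) ∷ [])
      ∷ []
      ∷ []
      ∷ []
      ∷ [])
      (coinvF (ite (# 0) v₂ v₃) 0 (ite (# 1) v₀ v₁) 1 (ite (# 1) v₁ v₀) 1 ≐ ⊥f)
      refl (y1 ∷ x1 ∷ y ∷ x ∷ []) (f ∷ f1 ∷ [])
      ((h0 , tt) , (tt , (tt , (tt , tt))))

  typeI-row-i-under-other : ∀ (x y x1 y1 A : ℕ) (f f1 : Bool)
    → f1 ≡ nextFlagI f x y x1 y1
    → coinvB x 0 x1 1 A 0 ≡ false
    → coinvB y 0 y1 1 A 0 ≡ false
    → (coinvB (if f then x else y) 0 (if f1 then x1 else y1) 1 A 0) ≡ false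
  typeI-row-i-under-other x y x1 y1 A f f1 h0 h1 h2 =
    by-order-type
      ( ((coinvF v₄ 0 v₂ 1 v₀ 0 ≐ ⊥f) ∷ (coinvF v₃ 0 v₁ 1 v₀ 0 ≐ ⊥f) ∷ [])
      ∷ ((flag (# 1) ≐ nextFlagIF v₃ v₂ v₁ v₀) ∷ [])
      ∷ []
      ∷ []
      ∷ []
      ∷ [])
      (coinvF (ite (# 0) v₄ v₃) 0 (ite (# 1) v₂ v₁) 1 v₀ 0 ≐ ⊥f)
      refl (A ∷ y1 ∷ x1 ∷ y ∷ x ∷ []) (f ∷ f1 ∷ [])
      ((h1 , h2 , tt) , ((h0 , tt) , (tt , (tt , (tt , tt)))))

  typeI-row-i+1-under-short : ∀ (x y x1 y1 A : ℕ) (f f1 : Bool)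
    → f1 ≡ nextFlagI f x y x1 y1
    → coinvB x 0 x1 1 A 0 ≡ false
    → coinvB y 0 y1 1 A 0 ≡ false
    → (coinvB (if f then y else x) 0 (if f1 then y1 else x1) 1 A 0) ≡ false
  typeI-row-i+1-under-short x y x1 y1 A f f1 h0 h1 h2 =
    by-order-type
      ( ((coinvF v₄ 0 v₂ 1 v₀ 0 ≐ ⊥f) ∷ (coinvF v₃ 0 v₁ 1 v₀ 0 ≐ ⊥f) ∷ [])
      ∷ ((flag (# 1) ≐ nextFlagIF v₃ v₂ v₁ v₀) ∷ [])
      ∷ []
      ∷ []
      ∷ []
      ∷ [])
      (coinvF (ite (# 0) v₃ v₄) 0 (ite (# 1) v₁ v₂) 1 v₀ 0 ≐ ⊥f)
      refl (A ∷ y1 ∷ x1 ∷ y ∷ x ∷ []) (f ∷ f1 ∷ [])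
      ((h1 , h2 , tt) , ((h0 , tt) , (tt , (tt , (tt , tt)))))

  typeI-row-i+1-under-cyclic : ∀ (x y x1 y1 A : ℕ) (f f1 : Bool)
    → f1 ≡ nextFlagI f x y x1 y1
    → coinvB x 0 x1 1 A 0 ≡ false
    → (if f then coinvB A 0 x 0 y 0 else true) ≡ true
    → (coinvB (if f then y else x) 0 (if f1 then y1 else x1) 1 A 0) ≡ false
  typeI-row-i+1-under-cyclic x y x1 y1 A f f1 h0 h1 h2 =
    by-order-type
      ( ((flag (# 1) ≐ nextFlagIF v₄ v₃ v₁ v₀) ∷ [])
      ∷ ((coinvF v₃ 0 v₀ 1 v₁ 0 ≐ ⊥f) ∷ [])
      ∷ ((flag (# 0) ⇒f coinvF v₀ 0 v₂ 0 v₁ 0 ≐ ⊤f) ∷ [])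
      ∷ []
      ∷ []
      ∷ [])
      (coinvF (ite (# 0) v₃ v₄) 0 (ite (# 1) v₀ v₁) 1 v₂ 0 ≐ ⊥f)
      refl (y1 ∷ x1 ∷ A ∷ y ∷ x ∷ []) (f ∷ f1 ∷ [])
      ((h0 , tt) , ((h1 , tt) , ((h2 , tt) , (tt , (tt , tt)))))

  typeI-row-i+1-under-end : ∀ (x y x1 A : ℕ) (f : Bool)
    → coinvB x 0 x1 1 A 0 ≡ false
    → (if f then coinvB A 0 x 0 y 0 else true) ≡ true
    → (coinvB (if f then y else x) 0 x1 1 A 0) ≡ false
  typeI-row-i+1-under-end x y x1 A f h0 h1 =
    by-order-type
      ( ((coinvF v₃ 0 v₀ 1 v₂ 0 ≐ ⊥f) ∷ [])
      ∷ ((flag (# 0) ⇒f coinvF v₁ 0 v₂ 0 v₀ 0 ≐ ⊤f) ∷ [])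
      ∷ []
      ∷ []
      ∷ [])
      (coinvF (ite (# 0) v₁ v₃) 0 v₀ 1 v₂ 0 ≐ ⊥f)
      refl (x1 ∷ y ∷ A ∷ x ∷ []) (f ∷ [])
      ((h0 , tt) , ((h1 , tt) , (tt , (tt , tt))))

  typeI-over-row-i-cyclic : ∀ (A A1 x y : ℕ) (f : Bool)
    → coinvB A 0 A1 1 y 0 ≡ false
    → (if f then coinvB A 0 x 0 y 0 else true) ≡ true
    → (coinvB A 0 A1 1 (if f then x else y) 0) ≡ false
  typeI-over-row-i-cyclic A A1 x y f h0 h1 =
    by-order-type
      ( ((flag (# 0) ⇒f coinvF v₃ 0 v₀ 0 v₂ 0 ≐ ⊤f) ∷ [])
      ∷ ((coinvF v₂ 0 v₀ 1 v₁ 0 ≐ ⊥f) ∷ [])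
      ∷ []
      ∷ []
      ∷ [])
      (coinvF v₃ 0 v₁ 1 (ite (# 0) v₀ v₂) 0 ≐ ⊥f)
      refl (x ∷ A1 ∷ y ∷ A ∷ []) (f ∷ [])
      ((h1 , tt) , ((h0 , tt) , (tt , (tt , tt))))

  typeII-row-i-over-other : ∀ (x y x1 y1 A1 : ℕ) (f f1 : Bool)
    → f1 ≡ nextFlagI f x y x1 y1
    → coinvB x 0 x1 1 A1 1 ≡ false
    → coinvB y 0 y1 1 A1 1 ≡ false
    → (coinvB (if f then x else y) 0 (if f1 then x1 else y1) 1 A1 1) ≡ false
  typeII-row-i-over-other x y x1 y1 A1 f f1 h0 h1 h2 =
    by-order-type
      ( ((coinvF v₄ 0 v₂ 1 v₀ 1 ≐ ⊥f) ∷ (coinvF v₃ 0 v₁ 1 v₀ 1 ≐ ⊥f) ∷ [])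
      ∷ ((flag (# 1) ≐ nextFlagIF v₃ v₂ v₁ v₀) ∷ [])
      ∷ []
      ∷ []
      ∷ []
      ∷ [])
      (coinvF (ite (# 0) v₄ v₃) 0 (ite (# 1) v₂ v₁) 1 v₀ 1 ≐ ⊥f)
      refl (A1 ∷ y1 ∷ x1 ∷ y ∷ x ∷ []) (f ∷ f1 ∷ [])
      ((h1 , h2 , tt) , ((h0 , tt) , (tt , (tt , (tt , tt)))))

  typeII-row-i+1-over-short : ∀ (x y x1 y1 A1 : ℕ) (f f1 : Bool)
    → f1 ≡ nextFlagI f x y x1 y1
    → coinvB x 0 x1 1 A1 1 ≡ false
    → coinvB y 0 y1 1 A1 1 ≡ false
    → (coinvB (if f then y else x) 0 (if f1 then y1 else x1) 1 A1 1) ≡ false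
  typeII-row-i+1-over-short x y x1 y1 A1 f f1 h0 h1 h2 =
    by-order-type
      ( ((coinvF v₄ 0 v₂ 1 v₀ 1 ≐ ⊥f) ∷ (coinvF v₃ 0 v₁ 1 v₀ 1 ≐ ⊥f) ∷ [])
      ∷ ((flag (# 1) ≐ nextFlagIF v₃ v₂ v₁ v₀) ∷ [])
      ∷ []
      ∷ []
      ∷ []
      ∷ [])
      (coinvF (ite (# 0) v₃ v₄) 0 (ite (# 1) v₁ v₂) 1 v₀ 1 ≐ ⊥f)
      refl (A1 ∷ y1 ∷ x1 ∷ y ∷ x ∷ []) (f ∷ f1 ∷ [])
      ((h1 , h2 , tt) , ((h0 , tt) , (tt , (tt , (tt , tt)))))

  typeII-row-i+1-over-cyclic : ∀ (x y x1 y1 A A1 : ℕ) (f f1 : Bool)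
    → f1 ≡ nextFlagI f x y x1 y1
    → coinvB x 0 x1 1 A1 1 ≡ false
    → coinvB A 0 A1 1 y 0 ≡ false
    → (if f then coinvB A 0 x 0 y 0 else true) ≡ true
    → (coinvB (if f then y else x) 0 (if f1 then y1 else x1) 1 A1 1) ≡ false
  typeII-row-i+1-over-cyclic x y x1 y1 A A1 f f1 h0 h1 h2 h3 =
    by-order-type
      ( ((flag (# 1) ≐ nextFlagIF v₅ v₄ v₁ v₀) ∷ [])
      ∷ ((coinvF v₄ 0 v₀ 1 v₁ 1 ≐ ⊥f) ∷ [])
      ∷ ((coinvF v₁ 0 v₀ 1 v₂ 0 ≐ ⊥f) ∷ [])
      ∷ ((flag (# 0) ⇒f coinvF v₀ 0 v₂ 0 v₁ 0 ≐ ⊤f) ∷ [])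
      ∷ []
      ∷ []
      ∷ [])
      (coinvF (ite (# 0) v₄ v₅) 0 (ite (# 1) v₀ v₁) 1 v₂ 1 ≐ ⊥f)
      refl (y1 ∷ x1 ∷ A1 ∷ A ∷ y ∷ x ∷ []) (f ∷ f1 ∷ [])
      ((h0 , tt) , ((h1 , tt) , ((h2 , tt) , ((h3 , tt) , (tt , (tt , tt))))))

  typeII-row-i+1-over-end : ∀ (x y x1 A A1 : ℕ) (f : Bool)
    → coinvB x 0 x1 1 A1 1 ≡ false
    → coinvB A 0 A1 1 y 0 ≡ false
    → (if f then coinvB A 0 x 0 y 0 else true) ≡ true
    → (coinvB (if f then y else x) 0 x1 1 A1 1) ≡ false
  typeII-row-i+1-over-end x y x1 A A1 f h0 h1 h2 =
    by-order-type
      ( ((coinvF v₄ 0 v₀ 1 v₁ 1 ≐ ⊥f) ∷ [])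
      ∷ ((coinvF v₁ 0 v₀ 1 v₂ 0 ≐ ⊥f) ∷ [])
      ∷ ((flag (# 0) ⇒f coinvF v₀ 0 v₂ 0 v₁ 0 ≐ ⊤f) ∷ [])
      ∷ []
      ∷ []
      ∷ [])
      (coinvF (ite (# 0) v₃ v₄) 0 v₀ 1 v₁ 1 ≐ ⊥f)
      refl (x1 ∷ A1 ∷ A ∷ y ∷ x ∷ []) (f ∷ [])
      ((h0 , tt) , ((h1 , tt) , ((h2 , tt) , (tt , (tt , tt)))))

  typeII-under-row-i-cyclic : ∀ (x y x1 y1 A A1 : ℕ) (f f1 : Bool)
    → f1 ≡ nextFlagI f x y x1 y1
    → coinvB x 0 x1 1 A 0 ≡ false
    → coinvB A 0 A1 1 y1 1 ≡ false
    → (if f then coinvB A 0 x 0 y 0 else true) ≡ true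
    → (coinvB A 0 A1 1 (if f1 then x1 else y1) 1) ≡ false
  typeII-under-row-i-cyclic x y x1 y1 A A1 f f1 h0 h1 h2 h3 =
    by-order-type
      ( ((coinvF v₄ 0 v₀ 1 v₁ 1 ≐ ⊥f) ∷ [])
      ∷ ((flag (# 1) ≐ nextFlagIF v₄ v₂ v₁ v₀) ∷ [])
      ∷ ((coinvF v₃ 0 v₀ 1 v₂ 0 ≐ ⊥f) ∷ [])
      ∷ ((flag (# 0) ⇒f coinvF v₁ 0 v₂ 0 v₀ 0 ≐ ⊤f) ∷ [])
      ∷ []
      ∷ []
      ∷ [])
      (coinvF v₄ 0 v₀ 1 (ite (# 1) v₂ v₁) 1 ≐ ⊥f)
      refl (A1 ∷ y1 ∷ x1 ∷ y ∷ A ∷ x ∷ []) (f ∷ f1 ∷ [])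
      ((h2 , tt) , ((h0 , tt) , ((h1 , tt) , ((h3 , tt) , (tt , (tt , tt))))))

module E0Patterns where

  open OrderTypes

  clash : ℕ → ℕ → ℕ → Bool
  clash α β γ = coinvB α 0 β 1 γ 0 ∨ ((α ≡ᵇ γ) ∨ (β ≡ᵇ γ))

  nextFlag0 : Bool → ℕ → ℕ → ℕ → ℕ → Bool
  nextFlag0 f y₋ x y x′ = if f then not (clash x x′ y) else clash y₋ y x′

  clashF : ∀ {k b} → Term k b → Term k b → Term k b → Formula k b
  clashF α β γ = coinvF α 0 β 1 γ 0 ∨f (eq α γ ∨f eq β γ)

  nextFlag0F : ∀ {k b} → Term k (suc b) → Term k (suc b) → Term k (suc b) → Term k (suc b) → Formula k (suc b)
  nextFlag0F y₋ x y x′ = iteF (flag (# 0)) (¬f (clashF x x′ y)) (clashF y₋ y x′)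

  cyclic-start : ∀ (b₁ bₙ x1 y1 A1 : ℕ)
    → (x1 ≡ᵇ b₁) ≡ true
    → ltB b₁ 1 A1 0 ≡ true
    → ltB A1 1 bₙ 0 ≡ true
    → (x1 ≡ᵇ A1) ≡ false
    → (y1 ≡ᵇ A1) ≡ false
    → coinvB bₙ 0 y1 1 A1 1 ≡ false
    → coinvB A1 0 y1 0 x1 0 ≡ true
  cyclic-start b₁ bₙ x1 y1 A1 h0 h1 h2 h3 h4 h5 =
    by-order-type
      ( ((eq v₀ v₄ ≐ ⊥f) ∷ (coinvF v₁ 0 v₀ 1 v₄ 1 ≐ ⊥f) ∷ [])
      ∷ ((lt v₃ 1 v₀ 0 ≐ ⊤f) ∷ [])
      ∷ ((eq v₀ v₁ ≐ ⊤f) ∷ (eq v₀ v₂ ≐ ⊥f) ∷ [])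
      ∷ ((lt v₀ 1 v₁ 0 ≐ ⊤f) ∷ [])
      ∷ []
      ∷ [])
      (coinvF v₄ 0 v₀ 0 v₂ 0 ≐ ⊤f)
      refl (y1 ∷ bₙ ∷ x1 ∷ b₁ ∷ A1 ∷ []) []
      ((h4 , h5 , tt) , ((h2 , tt) , ((h0 , h3 , tt) , ((h1 , tt) , (tt , tt)))))

  cyclic-step : ∀ (y₋ x y x1 y1 A A1 : ℕ) (f f1 : Bool)
    → f1 ≡ nextFlag0 f y₋ x y x1
    → (if f then coinvB A 0 y 0 x 0 else true) ≡ true
    → coinvB A 0 A1 1 x1 1 ≡ false
    → coinvB y 0 y1 1 A1 1 ≡ false
    → coinvB y₋ 0 y 1 A 1 ≡ false
    → (x1 ≡ᵇ A1) ≡ false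
    → (x1 ≡ᵇ y1) ≡ false
    → (y1 ≡ᵇ A1) ≡ false
    → (if f1 then coinvB A1 0 y1 0 x1 0 else true) ≡ true
  cyclic-step y₋ x y x1 y1 A A1 f f1 h0 h1 h2 h3 h4 h5 h6 h7 =
    by-order-type
      ( ((flag (# 1) ≐ nextFlag0F v₁ v₀ v₆ v₅) ∷ (flag (# 0) ⇒f coinvF v₂ 0 v₆ 0 v₀ 0 ≐ ⊤f) ∷ [])
      ∷ ((coinvF v₀ 0 v₅ 1 v₁ 1 ≐ ⊥f) ∷ [])
      ∷ ((coinvF v₀ 0 v₂ 1 v₃ 1 ≐ ⊥f) ∷ [])
      ∷ ((coinvF v₃ 0 v₀ 1 v₁ 1 ≐ ⊥f) ∷ (eq v₂ v₀ ≐ ⊥f) ∷ (eq v₀ v₁ ≐ ⊥f) ∷ [])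
      ∷ ((eq v₁ v₀ ≐ ⊥f) ∷ [])
      ∷ []
      ∷ []
      ∷ [])
      (flag (# 1) ⇒f coinvF v₄ 0 v₃ 0 v₅ 0 ≐ ⊤f)
      refl (x ∷ y₋ ∷ A ∷ y1 ∷ A1 ∷ x1 ∷ y ∷ []) (f ∷ f1 ∷ [])
      ((h0 , h1 , tt) , ((h4 , tt) , ((h2 , tt) , ((h3 , h6 , h7 , tt) , ((h5 , tt) , (tt , (tt , tt)))))))

  typeI-start : ∀ (b₁ bₙ x1 : ℕ)
    → (x1 ≡ᵇ b₁) ≡ true
    → coinvB b₁ 0 x1 1 bₙ 0 ≡ false
  typeI-start b₁ bₙ x1 h0 =
    by-order-type
      ( []
      ∷ ((eq v₀ v₁ ≐ ⊤f) ∷ [])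
      ∷ []
      ∷ [])
      (coinvF v₂ 0 v₁ 1 v₀ 0 ≐ ⊥f)
      refl (bₙ ∷ x1 ∷ b₁ ∷ []) []
      (tt , ((h0 , tt) , (tt , tt)))

  window-typeI : ∀ (y₋ x y x1 : ℕ) (f f1 : Bool)
    → f1 ≡ nextFlag0 f y₋ x y x1
    → (y ≡ᵇ x1) ≡ false
    → (coinvB (if f then x else y₋) 0 (if f1 then x1 else y) 1 (if f1 then y else x1) 0) ≡ false
  window-typeI y₋ x y x1 f f1 h0 h1 =
    by-order-type
      ( ((flag (# 1) ≐ nextFlag0F v₁ v₀ v₃ v₂) ∷ [])
      ∷ []
      ∷ ((eq v₁ v₀ ≐ ⊥f) ∷ [])
      ∷ []
      ∷ [])
      (coinvF (ite (# 0) v₀ v₁) 0 (ite (# 1) v₂ v₃) 1 (ite (# 1) v₃ v₂) 0 ≐ ⊥f)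
      refl (x ∷ y₋ ∷ x1 ∷ y ∷ []) (f ∷ f1 ∷ [])
      ((h0 , tt) , (tt , ((h1 , tt) , (tt , tt))))

  window-distinct : ∀ (y₋ x y x1 : ℕ) (f f1 : Bool)
    → f1 ≡ nextFlag0 f y₋ x y x1
    → (y ≡ᵇ x1) ≡ false
    → ((if f then x else y₋) ≡ᵇ (if f1 then y else x1)) ≡ false
  window-distinct y₋ x y x1 f f1 h0 h1 =
    by-order-type
      ( ((flag (# 1) ≐ nextFlag0F v₁ v₀ v₃ v₂) ∷ [])
      ∷ []
      ∷ ((eq v₁ v₀ ≐ ⊥f) ∷ [])
      ∷ []
      ∷ [])
      (eq (ite (# 0) v₀ v₁) (ite (# 1) v₃ v₂) ≐ ⊥f)
      refl (x ∷ y₋ ∷ x1 ∷ y ∷ []) (f ∷ f1 ∷ [])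
      ((h0 , tt) , (tt , ((h1 , tt) , (tt , tt))))

  typeI-row-1-under-short : ∀ (y₋ x y x1 A : ℕ) (f f1 : Bool)
    → f1 ≡ nextFlag0 f y₋ x y x1
    → coinvB x 0 x1 1 A 0 ≡ false
    → coinvB y₋ 0 y 1 A 1 ≡ false
    → (y ≡ᵇ A) ≡ false
    → (coinvB (if f then x else y₋) 0 (if f1 then x1 else y) 1 A 0) ≡ false
  typeI-row-1-under-short y₋ x y x1 A f f1 h0 h1 h2 h3 =
    by-order-type
      ( ((flag (# 1) ≐ nextFlag0F v₂ v₁ v₄ v₀) ∷ (coinvF v₁ 0 v₀ 1 v₃ 0 ≐ ⊥f) ∷ [])
      ∷ []
      ∷ ((coinvF v₀ 0 v₂ 1 v₁ 1 ≐ ⊥f) ∷ [])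
      ∷ ((eq v₁ v₀ ≐ ⊥f) ∷ [])
      ∷ []
      ∷ [])
      (coinvF (ite (# 0) v₁ v₂) 0 (ite (# 1) v₀ v₄) 1 v₃ 0 ≐ ⊥f)
      refl (x1 ∷ x ∷ y₋ ∷ A ∷ y ∷ []) (f ∷ f1 ∷ [])
      ((h0 , h1 , tt) , (tt , ((h2 , tt) , ((h3 , tt) , (tt , tt)))))

  typeI-row-1-under-cyclic : ∀ (y₋ x y x1 A : ℕ) (f f1 : Bool)
    → f1 ≡ nextFlag0 f y₋ x y x1
    → (if f then coinvB A 0 y 0 x 0 else true) ≡ true
    → coinvB y₋ 0 y 1 A 1 ≡ false
    → (y ≡ᵇ A) ≡ false
    → (coinvB (if f then x else y₋) 0 (if f1 then x1 else y) 1 A 0) ≡ false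
  typeI-row-1-under-cyclic y₋ x y x1 A f f1 h0 h1 h2 h3 =
    by-order-type
      ( ((flag (# 1) ≐ nextFlag0F v₂ v₁ v₄ v₀) ∷ [])
      ∷ ((flag (# 0) ⇒f coinvF v₂ 0 v₃ 0 v₀ 0 ≐ ⊤f) ∷ [])
      ∷ ((coinvF v₀ 0 v₂ 1 v₁ 1 ≐ ⊥f) ∷ [])
      ∷ ((eq v₁ v₀ ≐ ⊥f) ∷ [])
      ∷ []
      ∷ [])
      (coinvF (ite (# 0) v₁ v₂) 0 (ite (# 1) v₀ v₄) 1 v₃ 0 ≐ ⊥f)
      refl (x1 ∷ x ∷ y₋ ∷ A ∷ y ∷ []) (f ∷ f1 ∷ [])
      ((h0 , tt) , ((h1 , tt) , ((h2 , tt) , ((h3 , tt) , (tt , tt)))))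

  typeI-row-1-under-end : ∀ (y₋ x y A : ℕ) (f : Bool)
    → (if f then coinvB A 0 y 0 x 0 else true) ≡ true
    → coinvB y₋ 0 y 1 A 1 ≡ false
    → (y ≡ᵇ A) ≡ false
    → (coinvB (if f then x else y₋) 0 y 1 A 0) ≡ false
  typeI-row-1-under-end y₋ x y A f h0 h1 h2 =
    by-order-type
      ( ((flag (# 0) ⇒f coinvF v₂ 0 v₃ 0 v₀ 0 ≐ ⊤f) ∷ [])
      ∷ ((coinvF v₀ 0 v₂ 1 v₁ 1 ≐ ⊥f) ∷ [])
      ∷ ((eq v₁ v₀ ≐ ⊥f) ∷ [])
      ∷ []
      ∷ [])
      (coinvF (ite (# 0) v₀ v₁) 0 v₃ 1 v₂ 0 ≐ ⊥f)
      refl (x ∷ y₋ ∷ A ∷ y ∷ []) (f ∷ [])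
      ((h0 , tt) , ((h1 , tt) , ((h2 , tt) , (tt , tt))))

  typeI-row-1-under-beyond : ∀ (y₋ y A : ℕ)
    → coinvB y₋ 0 y 1 A 1 ≡ false
    → (y ≡ᵇ A) ≡ false
    → coinvB y₋ 0 y 1 A 0 ≡ false
  typeI-row-1-under-beyond y₋ y A h0 h1 =
    by-order-type
      ( ((coinvF v₀ 0 v₂ 1 v₁ 1 ≐ ⊥f) ∷ [])
      ∷ ((eq v₁ v₀ ≐ ⊥f) ∷ [])
      ∷ []
      ∷ [])
      (coinvF v₀ 0 v₂ 1 v₁ 0 ≐ ⊥f)
      refl (y₋ ∷ A ∷ y ∷ []) []
      ((h0 , tt) , ((h1 , tt) , (tt , tt)))

  typeI-over-row-n-start : ∀ (R bₙ A1 : ℕ)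
    → ltB R 0 bₙ 0 ≡ true
    → ltB A1 1 R 0 ≡ true
    → coinvB R 0 A1 1 bₙ 0 ≡ false
  typeI-over-row-n-start R bₙ A1 h0 h1 =
    by-order-type
      ( ((lt v₀ 1 v₂ 0 ≐ ⊤f) ∷ [])
      ∷ ((lt v₁ 0 v₀ 0 ≐ ⊤f) ∷ [])
      ∷ []
      ∷ [])
      (coinvF v₂ 0 v₀ 1 v₁ 0 ≐ ⊥f)
      refl (A1 ∷ bₙ ∷ R ∷ []) []
      ((h1 , tt) , ((h0 , tt) , (tt , tt)))

  typeI-over-row-n-long : ∀ (y x1 A A1 : ℕ) (f1 : Bool)
    → coinvB A 0 A1 1 y 0 ≡ false
    → coinvB A 0 A1 1 x1 1 ≡ false
    → (x1 ≡ᵇ A1) ≡ false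
    → (coinvB A 0 A1 1 (if f1 then y else x1) 0) ≡ false
  typeI-over-row-n-long y x1 A A1 f1 h0 h1 h2 =
    by-order-type
      ( ((coinvF v₁ 0 v₃ 1 v₀ 0 ≐ ⊥f) ∷ [])
      ∷ ((coinvF v₀ 0 v₂ 1 v₁ 1 ≐ ⊥f) ∷ [])
      ∷ ((eq v₀ v₁ ≐ ⊥f) ∷ [])
      ∷ []
      ∷ [])
      (coinvF v₁ 0 v₃ 1 (ite (# 0) v₀ v₂) 0 ≐ ⊥f)
      refl (y ∷ A ∷ x1 ∷ A1 ∷ []) (f1 ∷ [])
      ((h0 , tt) , ((h1 , tt) , ((h2 , tt) , (tt , tt))))

  typeI-over-row-n-cyclic : ∀ (y₋ x y x1 A A1 : ℕ) (f f1 : Bool)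
    → f1 ≡ nextFlag0 f y₋ x y x1
    → (if f then coinvB A 0 y 0 x 0 else true) ≡ true
    → coinvB A 0 A1 1 x1 1 ≡ false
    → coinvB y₋ 0 y 1 A 1 ≡ false
    → (x1 ≡ᵇ A1) ≡ false
    → (coinvB A 0 A1 1 (if f1 then y else x1) 0) ≡ false
  typeI-over-row-n-cyclic y₋ x y x1 A A1 f f1 h0 h1 h2 h3 h4 =
    by-order-type
      ( ((flag (# 1) ≐ nextFlag0F v₁ v₀ v₅ v₄) ∷ (flag (# 0) ⇒f coinvF v₂ 0 v₅ 0 v₀ 0 ≐ ⊤f) ∷ [])
      ∷ ((coinvF v₀ 0 v₄ 1 v₁ 1 ≐ ⊥f) ∷ [])
      ∷ ((coinvF v₀ 0 v₁ 1 v₂ 1 ≐ ⊥f) ∷ [])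
      ∷ ((eq v₁ v₀ ≐ ⊥f) ∷ [])
      ∷ []
      ∷ []
      ∷ [])
      (coinvF v₂ 0 v₃ 1 (ite (# 1) v₅ v₄) 0 ≐ ⊥f)
      refl (x ∷ y₋ ∷ A ∷ A1 ∷ x1 ∷ y ∷ []) (f ∷ f1 ∷ [])
      ((h0 , h1 , tt) , ((h3 , tt) , ((h2 , tt) , ((h4 , tt) , (tt , (tt , tt))))))

  typeII-under-row-1-start : ∀ (b₁ R x1 A1 : ℕ)
    → (x1 ≡ᵇ b₁) ≡ true
    → ltB A1 1 R 0 ≡ true
    → ltB b₁ 1 A1 0 ≡ true
    → coinvB R 0 A1 1 x1 1 ≡ false
  typeII-under-row-1-start b₁ R x1 A1 h0 h1 h2 =
    by-order-type
      ( ((eq v₀ v₃ ≐ ⊤f) ∷ [])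
      ∷ ((lt v₁ 1 v₀ 0 ≐ ⊤f) ∷ [])
      ∷ ((lt v₁ 1 v₀ 0 ≐ ⊤f) ∷ [])
      ∷ []
      ∷ [])
      (coinvF v₁ 0 v₂ 1 v₀ 1 ≐ ⊥f)
      refl (x1 ∷ R ∷ A1 ∷ b₁ ∷ []) []
      ((h0 , tt) , ((h1 , tt) , ((h2 , tt) , (tt , tt))))

  typeII-under-row-1-inside : ∀ (y x1 A A1 : ℕ) (f1 : Bool)
    → coinvB A 0 A1 1 y 0 ≡ false
    → coinvB A 0 A1 1 x1 1 ≡ false
    → (y ≡ᵇ A) ≡ false
    → (coinvB A 0 A1 1 (if f1 then x1 else y) 1) ≡ false
  typeII-under-row-1-inside y x1 A A1 f1 h0 h1 h2 =
    by-order-type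
      ( ((coinvF v₃ 0 v₁ 1 v₀ 1 ≐ ⊥f) ∷ [])
      ∷ ((coinvF v₂ 0 v₀ 1 v₁ 0 ≐ ⊥f) ∷ [])
      ∷ ((eq v₀ v₁ ≐ ⊥f) ∷ [])
      ∷ []
      ∷ [])
      (coinvF v₃ 0 v₁ 1 (ite (# 0) v₀ v₂) 1 ≐ ⊥f)
      refl (x1 ∷ A1 ∷ y ∷ A ∷ []) (f1 ∷ [])
      ((h1 , tt) , ((h0 , tt) , ((h2 , tt) , (tt , tt))))

  typeII-under-row-1-beyond : ∀ (y A A1 : ℕ)
    → coinvB A 0 A1 1 y 0 ≡ false
    → (y ≡ᵇ A) ≡ false
    → coinvB A 0 A1 1 y 1 ≡ false
  typeII-under-row-1-beyond y A A1 h0 h1 =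
    by-order-type
      ( ((coinvF v₁ 0 v₀ 1 v₂ 0 ≐ ⊥f) ∷ [])
      ∷ ((eq v₁ v₀ ≐ ⊥f) ∷ [])
      ∷ []
      ∷ [])
      (coinvF v₁ 0 v₀ 1 v₂ 1 ≐ ⊥f)
      refl (A1 ∷ A ∷ y ∷ []) []
      ((h0 , tt) , ((h1 , tt) , (tt , tt)))

  typeII-row-n-over-start : ∀ (bₙ x1 y1 A1 x2 : ℕ) (f2 : Bool)
    → (y1 ≡ᵇ A1) ≡ false
    → coinvB bₙ 0 y1 1 A1 1 ≡ false
    → coinvB x1 0 x2 1 A1 0 ≡ false
    → f2 ≡ (not ((coinvB x1 0 x2 1 y1 0) ∨ ((x1 ≡ᵇ y1) ∨ (x2 ≡ᵇ y1))))
    → (coinvB bₙ 0 (if f2 then y1 else x2) 1 A1 1) ≡ false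
  typeII-row-n-over-start bₙ x1 y1 A1 x2 f2 h0 h1 h2 h3 =
    by-order-type
      ( ((coinvF v₁ 0 v₀ 1 v₃ 0 ≐ ⊥f) ∷ (flag (# 0) ≐ ¬f (clashF v₁ v₀ v₄)) ∷ [])
      ∷ []
      ∷ ((coinvF v₀ 0 v₂ 1 v₁ 1 ≐ ⊥f) ∷ [])
      ∷ ((eq v₁ v₀ ≐ ⊥f) ∷ [])
      ∷ []
      ∷ [])
      (coinvF v₂ 0 (ite (# 0) v₄ v₀) 1 v₃ 1 ≐ ⊥f)
      refl (x2 ∷ x1 ∷ bₙ ∷ A1 ∷ y1 ∷ []) (f2 ∷ [])
      ((h2 , h3 , tt) , (tt , ((h1 , tt) , ((h0 , tt) , (tt , tt)))))

  typeII-row-n-over : ∀ (y x1 y1 x2 A1 : ℕ) (f1 f2 : Bool)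
    → f2 ≡ nextFlag0 f1 y x1 y1 x2
    → coinvB x1 0 x2 1 A1 0 ≡ false
    → coinvB y 0 y1 1 A1 1 ≡ false
    → (x1 ≡ᵇ A1) ≡ false
    → (coinvB (if f1 then y else x1) 0 (if f2 then y1 else x2) 1 A1 1) ≡ false
  typeII-row-n-over y x1 y1 x2 A1 f1 f2 h0 h1 h2 h3 =
    by-order-type
      ( ((flag (# 1) ≐ nextFlag0F v₁ v₄ v₀ v₂) ∷ (coinvF v₁ 0 v₀ 1 v₃ 1 ≐ ⊥f) ∷ [])
      ∷ []
      ∷ ((coinvF v₂ 0 v₀ 1 v₁ 0 ≐ ⊥f) ∷ [])
      ∷ ((eq v₁ v₀ ≐ ⊥f) ∷ [])
      ∷ []
      ∷ [])
      (coinvF (ite (# 0) v₁ v₄) 0 (ite (# 1) v₀ v₂) 1 v₃ 1 ≐ ⊥f)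
      refl (y1 ∷ y ∷ x2 ∷ A1 ∷ x1 ∷ []) (f1 ∷ f2 ∷ [])
      ((h0 , h2 , tt) , (tt , ((h1 , tt) , ((h3 , tt) , (tt , tt)))))

module SSKDFacts {n : ℕ} {a : Vec ℕ n} {T : Filling} (T-sskd : SSKD n a T) where

  open Predicates

  T-entries : Entries n a T
  T-entries = proj₁ T-sskd

  T-nonattacking : NonAttacking n a T
  T-nonattacking = proj₁ (proj₂ T-sskd)

  T-typeI : ∀ {R c S} → Cell n a R c → Cell n a R (suc c) → Cell n a S c → R < S → row a S < row a R →
    coinvB (ent T R c) 0 (ent T R (suc c)) 1 (ent T S c) 0 ≡ false
  T-typeI {R} {c} {S} p q r s t =
    trans (sym (coinvI-columns c (ent T R c) (ent T R (suc c)) (ent T S c))) (proj₁ (proj₂ (proj₂ T-sskd)) R c S p q r s t)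

  T-typeII : ∀ {R c S} → Cell n a R c → Cell n a R (suc c) → Cell n a S (suc c) → S < R → row a S ≤ row a R →
    coinvB (ent T R c) 0 (ent T R (suc c)) 1 (ent T S (suc c)) 1 ≡ false
  T-typeII {R} {c} {S} p q r s t =
    trans (sym (coinvII-columns c (ent T R c) (ent T R (suc c)) (ent T S (suc c)))) (proj₂ (proj₂ (proj₂ T-sskd)) R c S p q r s t)

  T-column-distinct : ∀ {R S c} → Cell n a R c → Cell n a S c → R ≢ S → (ent T R c ≡ᵇ ent T S c) ≡ false
  T-column-distinct {R} {S} {c} p q R≢S =
    trans (sym (attackB-same-column R S c (ent T R c) (ent T S c) R≢S)) (T-nonattacking R c S c p q)

  T-diagonal-distinct : ∀ {R S c} → Cell n a R c → Cell n a S (suc c) → S < R →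
    (ent T R c ≡ᵇ ent T S (suc c)) ≡ false
  T-diagonal-distinct {R} {S} {c} p q S<R =
    trans (sym (attackB-next-column R S c (ent T R c) (ent T S (suc c)) S<R)) (T-nonattacking R c S (suc c) p q)

  T-entry-bounds : ∀ {R c} → Cell n a R (suc c) → 1 ≤ T R (suc c) × T R (suc c) ≤ n
  T-entry-bounds {R} {c} cell = T-entries R (suc c) (cell , s≤s z≤n)

  -- The basement entry e in row e would attack an entry e in column 1 of a lower row.

  column-one-≤-row : ∀ {R} → Cell n a R 1 → T R 1 ≤ R
  column-one-≤-row {R} cell with R <? T R 1
  ... | no R≮e = ≮⇒≥ R≮e
  ... | yes R<e = ⊥-elim (true≢false (trans (sym attacks) (T-nonattacking e 0 R 1 basement cell)))
    where
    e = T R 1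
    basement : Cell n a e 0
    basement = proj₁ (T-entry-bounds cell) , proj₂ (T-entry-bounds cell) , z≤n
    attacks : attackB e 0 e R 1 e ≡ true
    attacks = trans (attackB-next-column e R 0 e e R<e) (≡ᵇ-true {e} refl)
    true≢false : true ≢ false
    true≢false ()

  column-one-row-one : 0 < row a 1 → 1 ≤ n → T 1 1 ≡ 1
  column-one-row-one a₁>0 1≤n = ≤-antisym (column-one-≤-row cell) (proj₁ (T-entry-bounds cell))
    where cell = s≤s z≤n , 1≤n , a₁>0

module EiProof (n j : ℕ) (a : Vec ℕ n) (T : Filling) (T-sskd : SSKD n a T)
  (shorter : row a (suc j + 1) < row a (suc j)) (i<n : suc j < n) where

  open Predicates
  open EiPatterns
  open SSKDFacts T-sskd

  i i⁺ aᵢ aᵢ₊₁ : ℕ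
  i    = suc j
  i⁺   = suc j + 1
  aᵢ   = row a i
  aᵢ₊₁ = row a i⁺

  x y : ℕ → ℕ
  x c = ent T i c
  y c = ent T i⁺ c

  f : ℕ → Bool
  f = flagI n i a T

  U : Filling
  U = Ei n i a T

  b : Vec ℕ n
  b = sAct n i a

  i⁺≡suc-i : i⁺ ≡ suc i
  i⁺≡suc-i = cong suc (+-comm j 1)

  i<i⁺ : i < i⁺
  i<i⁺ = subst (i <_) (sym i⁺≡suc-i) ≤-refl

  i⁺≤n : i⁺ ≤ n
  i⁺≤n = subst (_≤ n) (sym i⁺≡suc-i) i<n

  i≢i⁺ : i ≢ i⁺
  i≢i⁺ = <⇒≢ i<i⁺

  aᵢ₊₁≤aᵢ : aᵢ₊₁ ≤ aᵢ
  aᵢ₊₁≤aᵢ = <⇒≤ shorter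

  below-i⁺ : ∀ {R} → R < i⁺ → R ≢ i → R < i
  below-i⁺ {R} R<i⁺ R≢i with m≤n⇒m<n∨m≡n (subst (R <_) i⁺≡suc-i R<i⁺)
  ... | inj₁ (s≤s R<i) = R<i
  ... | inj₂ R≡i       = ⊥-elim (R≢i (cong pred R≡i))

  above-i : ∀ {S} → i < S → S ≢ i⁺ → i⁺ < S
  above-i {S} i<S S≢i⁺ with m≤n⇒m<n∨m≡n i<S
  ... | inj₁ i⁺<S = subst (_< S) (sym i⁺≡suc-i) i⁺<S
  ... | inj₂ i⁺≡S = ⊥-elim (S≢i⁺ (trans (sym i⁺≡S) (sym i⁺≡suc-i)))

  row-b : ∀ R → 1 ≤ R → R ≤ n →
    row b R ≡ (if R ≡ᵇ i then row a (i + 1) else if R ≡ᵇ i + 1 then row a i else row a R)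
  row-b = row-tabulate n (λ R → if R ≡ᵇ i then row a (i + 1) else if R ≡ᵇ i + 1 then row a i else row a R)

  row-b-i : row b i ≡ aᵢ₊₁
  row-b-i = trans (row-b i (s≤s z≤n) (<⇒≤ i<n)) (if-then (≡ᵇ-true {i} refl))

  row-b-i⁺ : row b i⁺ ≡ aᵢ
  row-b-i⁺ = trans (row-b i⁺ (s≤s z≤n) i⁺≤n)
    (trans (if-else (≡ᵇ-false (λ e → i≢i⁺ (sym e)))) (if-then (≡ᵇ-true {i⁺} refl)))

  row-b-other : ∀ {R} → 1 ≤ R → R ≤ n → R ≢ i → R ≢ i⁺ → row b R ≡ row a R
  row-b-other {R} 1≤R R≤n R≢i R≢i⁺ =
    trans (row-b R 1≤R R≤n) (trans (if-else (≡ᵇ-false R≢i)) (if-else (≡ᵇ-false R≢i⁺)))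

  U-row-i : ∀ c → ent U i c ≡ (if f c then x c else y c)
  U-row-i zero    = refl
  U-row-i (suc c) = trans (if-else (≡ᵇ-false i≢i⁺)) (if-then (≡ᵇ-true {i} refl))

  U-row-i⁺ : ∀ c → ent U i⁺ c ≡ (if c ≤ᵇ aᵢ₊₁ then (if f c then y c else x c) else x c)
  U-row-i⁺ zero    = refl
  U-row-i⁺ (suc c) = if-then (≡ᵇ-true {i⁺} refl)

  U-row-i⁺-short : ∀ {c} → c ≤ aᵢ₊₁ → ent U i⁺ c ≡ (if f c then y c else x c)
  U-row-i⁺-short {c} c≤aᵢ₊₁ = trans (U-row-i⁺ c) (if-then (≤ᵇ-true c≤aᵢ₊₁))

  U-row-i⁺-long : ∀ {c} → aᵢ₊₁ < c → ent U i⁺ c ≡ x c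
  U-row-i⁺-long {c} aᵢ₊₁<c = trans (U-row-i⁺ c) (if-else (≤ᵇ-false aᵢ₊₁<c))

  U-other : ∀ {R} → R ≢ i → R ≢ i⁺ → ∀ c → ent U R c ≡ ent T R c
  U-other R≢i R≢i⁺ zero    = refl
  U-other R≢i R≢i⁺ (suc c) = trans (if-else (≡ᵇ-false R≢i⁺)) (if-else (≡ᵇ-false R≢i))

  flag-step : ∀ c → f (suc c) ≡ nextFlagI (f c) (x c) (y c) (x (suc c)) (y (suc c))
  flag-step c = cong₂ (λ p q → if f c then not p else q)
    (coinvII-columns c (y c) (y (suc c)) (x (suc c))) (coinvII-columns c (x c) (x (suc c)) (y (suc c)))

  cell-i : ∀ {c} → c ≤ aᵢ → Cell n a i c
  cell-i c≤aᵢ = s≤s z≤n , <⇒≤ i<n , c≤aᵢ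

  cell-i⁺ : ∀ {c} → c ≤ aᵢ₊₁ → Cell n a i⁺ c
  cell-i⁺ c≤aᵢ₊₁ = s≤s z≤n , i⁺≤n , c≤aᵢ₊₁

  cell-i-short : ∀ {c} → c ≤ aᵢ₊₁ → Cell n a i c
  cell-i-short c≤aᵢ₊₁ = cell-i (≤-trans c≤aᵢ₊₁ aᵢ₊₁≤aᵢ)

  b-cell-i : ∀ {c} → Cell n b i c → c ≤ aᵢ₊₁
  b-cell-i (_ , _ , c≤) = subst (_ ≤_) row-b-i c≤

  b-cell-i⁺ : ∀ {c} → Cell n b i⁺ c → c ≤ aᵢ
  b-cell-i⁺ (_ , _ , c≤) = subst (_ ≤_) row-b-i⁺ c≤

  row-b-other′ : ∀ {R c} → R ≢ i → R ≢ i⁺ → Cell n b R c → row b R ≡ row a R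
  row-b-other′ R≢i R≢i⁺ (1≤R , R≤n , _) = row-b-other 1≤R R≤n R≢i R≢i⁺

  b-cell-other : ∀ {R c} → R ≢ i → R ≢ i⁺ → Cell n b R c → Cell n a R c
  b-cell-other R≢i R≢i⁺ (1≤R , R≤n , c≤) = 1≤R , R≤n , subst (_ ≤_) (row-b-other 1≤R R≤n R≢i R≢i⁺) c≤

  -- The invariant behind E_i: while y stays above x (f c), the entries T R c, x c, y c of a row R
  -- of intermediate length are cyclically ordered.

  cyclic-below : ∀ {R} → 1 ≤ R → R < i → aᵢ₊₁ < row a R → row a R ≤ aᵢ → ∀ c → c ≤ row a R → c ≤ aᵢ₊₁ →
    (if f c then coinvB (ent T R c) 0 (x c) 0 (y c) 0 else true) ≡ true
  cyclic-below {R} R≥1 R<i _ _ zero _ _ = cyclic-start-below R i i⁺ (ltB-same-column R<i) (ltB-same-column i<i⁺)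
  cyclic-below {R} R≥1 R<i long short (suc c) c<a_R c<aᵢ₊₁ =
    cyclic-step-below (x c) (y c) (x (suc c)) (y (suc c)) (ent T R c) (ent T R (suc c)) (f c) (f (suc c))
      (flag-step c)
      (T-column-distinct (cell-i-short c<aᵢ₊₁) (cell-i⁺ c<aᵢ₊₁) i≢i⁺)
      (T-column-distinct cell-R₁ (cell-i-short c<aᵢ₊₁) (<⇒≢ R<i))
      (T-typeII (cell-i-short (<⇒≤ c<aᵢ₊₁)) (cell-i-short c<aᵢ₊₁) cell-R₁ R<i short)
      (T-typeI cell-R₀ cell-R₁ (cell-i⁺ (<⇒≤ c<aᵢ₊₁)) (<-trans R<i i<i⁺) long)
      (cyclic-below R≥1 R<i long short c (<⇒≤ c<a_R) (<⇒≤ c<aᵢ₊₁))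
    where
    cell-R₀ = R≥1 , ≤-trans (<⇒≤ R<i) (<⇒≤ i<n) , <⇒≤ c<a_R
    cell-R₁ = R≥1 , ≤-trans (<⇒≤ R<i) (<⇒≤ i<n) , c<a_R

  cyclic-above : ∀ {R} → R ≤ n → i⁺ < R → aᵢ₊₁ ≤ row a R → row a R < aᵢ → ∀ c → c ≤ row a R → c ≤ aᵢ₊₁ →
    (if f c then coinvB (ent T R c) 0 (x c) 0 (y c) 0 else true) ≡ true
  cyclic-above {R} R≤n i⁺<R _ _ zero _ _ = cyclic-start-above R i i⁺ (ltB-same-column i⁺<R) (ltB-same-column i<i⁺)
  cyclic-above {R} R≤n i⁺<R long short (suc c) c<a_R c<aᵢ₊₁ =
    cyclic-step-above (x c) (y c) (x (suc c)) (y (suc c)) (ent T R c) (ent T R (suc c)) (f c) (f (suc c))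
      (flag-step c)
      (T-column-distinct (cell-i-short c<aᵢ₊₁) (cell-i⁺ c<aᵢ₊₁) i≢i⁺)
      (T-column-distinct cell-R₁ (cell-i⁺ c<aᵢ₊₁) (>⇒≢ i⁺<R))
      (T-typeI (cell-i-short (<⇒≤ c<aᵢ₊₁)) (cell-i-short c<aᵢ₊₁) cell-R₀ (<-trans i<i⁺ i⁺<R) short)
      (T-typeII cell-R₀ cell-R₁ (cell-i⁺ c<aᵢ₊₁) i⁺<R long)
      (cyclic-above R≤n i⁺<R long short c (<⇒≤ c<a_R) (<⇒≤ c<aᵢ₊₁))
    where
    R≥1 = ≤-trans (s≤s z≤n) (<⇒≤ i⁺<R)
    cell-R₀ = R≥1 , R≤n , <⇒≤ c<a_R
    cell-R₁ = R≥1 , R≤n , c<a_R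

  typeI-i : ∀ c S → Cell n b i (suc c) → Cell n b S c → i⁺ < S → S ≢ i → S ≢ i⁺ → row a S < aᵢ₊₁ →
    coinvB (ent U i c) 0 (ent U i (suc c)) 1 (ent U S c) 0 ≡ false
  typeI-i c S cell-c+1 cell-S i⁺<S S≢i S≢i⁺ a_S<aᵢ₊₁ =
    trans (coinvB-cong 0 1 0 (U-row-i c) (U-row-i (suc c)) (U-other S≢i S≢i⁺ c))
      (typeI-row-i-under-other (x c) (y c) (x (suc c)) (y (suc c)) (ent T S c) (f c) (f (suc c)) (flag-step c)
        (T-typeI (cell-i-short (<⇒≤ c<aᵢ₊₁)) (cell-i-short c<aᵢ₊₁) cellᵀ-S (<-trans i<i⁺ i⁺<S) (<-trans a_S<aᵢ₊₁ shorter))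
        (T-typeI (cell-i⁺ (<⇒≤ c<aᵢ₊₁)) (cell-i⁺ c<aᵢ₊₁) cellᵀ-S i⁺<S a_S<aᵢ₊₁))
    where
    c<aᵢ₊₁ = b-cell-i cell-c+1
    cellᵀ-S = b-cell-other S≢i S≢i⁺ cell-S

  typeI-i⁺ : ∀ c S → Cell n b i⁺ (suc c) → Cell n b S c → i⁺ < S → S ≢ i → S ≢ i⁺ → row a S < aᵢ →
    coinvB (ent U i⁺ c) 0 (ent U i⁺ (suc c)) 1 (ent U S c) 0 ≡ false
  typeI-i⁺ c S cell-c+1 cell-S i⁺<S S≢i S≢i⁺ a_S<aᵢ with <-cmp c aᵢ₊₁
  ... | tri< c<aᵢ₊₁ _ _ =
    trans (coinvB-cong 0 1 0 (U-row-i⁺-short (<⇒≤ c<aᵢ₊₁)) (U-row-i⁺-short c<aᵢ₊₁) (U-other S≢i S≢i⁺ c)) shape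
    where
    cellᵀ-S = b-cell-other S≢i S≢i⁺ cell-S
    x-triple = T-typeI (cell-i-short (<⇒≤ c<aᵢ₊₁)) (cell-i-short c<aᵢ₊₁) cellᵀ-S (<-trans i<i⁺ i⁺<S) a_S<aᵢ
    shape : coinvB (if f c then y c else x c) 0 (if f (suc c) then y (suc c) else x (suc c)) 1 (ent T S c) 0 ≡ false
    shape with row a S <? aᵢ₊₁
    ... | yes a_S<aᵢ₊₁ =
      typeI-row-i+1-under-short (x c) (y c) (x (suc c)) (y (suc c)) (ent T S c) (f c) (f (suc c)) (flag-step c)
        x-triple (T-typeI (cell-i⁺ (<⇒≤ c<aᵢ₊₁)) (cell-i⁺ c<aᵢ₊₁) cellᵀ-S i⁺<S a_S<aᵢ₊₁)
    ... | no a_S≮aᵢ₊₁ =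
      typeI-row-i+1-under-cyclic (x c) (y c) (x (suc c)) (y (suc c)) (ent T S c) (f c) (f (suc c)) (flag-step c)
        x-triple (cyclic-above (proj₁ (proj₂ cellᵀ-S)) i⁺<S (≮⇒≥ a_S≮aᵢ₊₁) a_S<aᵢ c (proj₂ (proj₂ cellᵀ-S)) (<⇒≤ c<aᵢ₊₁))
  ... | tri≈ _ refl _ =
    trans (coinvB-cong 0 1 0 (U-row-i⁺-short ≤-refl) (U-row-i⁺-long ≤-refl) (U-other S≢i S≢i⁺ aᵢ₊₁))
      (typeI-row-i+1-under-end (x aᵢ₊₁) (y aᵢ₊₁) (x (suc aᵢ₊₁)) (ent T S aᵢ₊₁) (f aᵢ₊₁)
        (T-typeI (cell-i aᵢ₊₁≤aᵢ) (cell-i (b-cell-i⁺ cell-c+1)) cellᵀ-S (<-trans i<i⁺ i⁺<S) a_S<aᵢ)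
        (cyclic-above (proj₁ (proj₂ cellᵀ-S)) i⁺<S (proj₂ (proj₂ cellᵀ-S)) a_S<aᵢ aᵢ₊₁ (proj₂ (proj₂ cellᵀ-S)) ≤-refl))
    where
    cellᵀ-S = b-cell-other S≢i S≢i⁺ cell-S
  ... | tri> _ _ aᵢ₊₁<c =
    trans (coinvB-cong 0 1 0 (U-row-i⁺-long aᵢ₊₁<c) (U-row-i⁺-long (<-trans aᵢ₊₁<c ≤-refl)) (U-other S≢i S≢i⁺ c))
      (T-typeI (cell-i (<⇒≤ (b-cell-i⁺ cell-c+1))) (cell-i (b-cell-i⁺ cell-c+1)) (b-cell-other S≢i S≢i⁺ cell-S)
        (<-trans i<i⁺ i⁺<S) a_S<aᵢ)

  typeI-under-i : ∀ c R → Cell n b R c → Cell n b R (suc c) → Cell n b i c → R < i → R ≢ i → R ≢ i⁺ →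
    aᵢ₊₁ < row a R → coinvB (ent U R c) 0 (ent U R (suc c)) 1 (ent U i c) 0 ≡ false
  typeI-under-i c R cell-c cell-c+1 cell-i-c R<i R≢i R≢i⁺ aᵢ₊₁<a_R =
    trans (coinvB-cong 0 1 0 (U-other R≢i R≢i⁺ c) (U-other R≢i R≢i⁺ (suc c)) (U-row-i c)) shape
    where
    cellᵀ-c = b-cell-other R≢i R≢i⁺ cell-c
    cellᵀ-c+1 = b-cell-other R≢i R≢i⁺ cell-c+1
    c≤aᵢ₊₁ = b-cell-i cell-i-c
    y-triple = T-typeI cellᵀ-c cellᵀ-c+1 (cell-i⁺ c≤aᵢ₊₁) (<-trans R<i i<i⁺) aᵢ₊₁<a_R
    shape : coinvB (ent T R c) 0 (ent T R (suc c)) 1 (if f c then x c else y c) 0 ≡ false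
    shape with aᵢ <? row a R
    ... | yes aᵢ<a_R =
      if-both (λ z → coinvB (ent T R c) 0 (ent T R (suc c)) 1 z 0 ≡ false) (f c)
        (T-typeI cellᵀ-c cellᵀ-c+1 (cell-i-short c≤aᵢ₊₁) R<i aᵢ<a_R) y-triple
    ... | no aᵢ≮a_R =
      typeI-over-row-i-cyclic (ent T R c) (ent T R (suc c)) (x c) (y c) (f c) y-triple
        (cyclic-below (proj₁ cellᵀ-c) R<i aᵢ₊₁<a_R (≮⇒≥ aᵢ≮a_R) c (proj₂ (proj₂ cellᵀ-c)) c≤aᵢ₊₁)

  typeI-under-i⁺ : ∀ c R → Cell n b R c → Cell n b R (suc c) → Cell n b i⁺ c → R < i → R ≢ i → R ≢ i⁺ →
    aᵢ < row a R → coinvB (ent U R c) 0 (ent U R (suc c)) 1 (ent U i⁺ c) 0 ≡ false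
  typeI-under-i⁺ c R cell-c cell-c+1 cell-i⁺-c R<i R≢i R≢i⁺ aᵢ<a_R with c ≤? aᵢ₊₁
  ... | yes c≤aᵢ₊₁ =
    trans (coinvB-cong 0 1 0 (U-other R≢i R≢i⁺ c) (U-other R≢i R≢i⁺ (suc c)) (U-row-i⁺-short c≤aᵢ₊₁))
      (if-both (λ z → coinvB (ent T R c) 0 (ent T R (suc c)) 1 z 0 ≡ false) (f c)
        (T-typeI cellᵀ-c cellᵀ-c+1 (cell-i⁺ c≤aᵢ₊₁) (<-trans R<i i<i⁺) (<-trans shorter aᵢ<a_R))
        (T-typeI cellᵀ-c cellᵀ-c+1 (cell-i (b-cell-i⁺ cell-i⁺-c)) R<i aᵢ<a_R))
    where
    cellᵀ-c = b-cell-other R≢i R≢i⁺ cell-c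
    cellᵀ-c+1 = b-cell-other R≢i R≢i⁺ cell-c+1
  ... | no c≰aᵢ₊₁ =
    trans (coinvB-cong 0 1 0 (U-other R≢i R≢i⁺ c) (U-other R≢i R≢i⁺ (suc c)) (U-row-i⁺-long (≰⇒> c≰aᵢ₊₁)))
      (T-typeI (b-cell-other R≢i R≢i⁺ cell-c) (b-cell-other R≢i R≢i⁺ cell-c+1) (cell-i (b-cell-i⁺ cell-i⁺-c)) R<i aᵢ<a_R)

  typeI-by-rows : ∀ R c S → Cell n b R c → Cell n b R (suc c) → Cell n b S c → R < S → row b S < row b R →
    coinvB (ent U R c) 0 (ent U R (suc c)) 1 (ent U S c) 0 ≡ false
  typeI-by-rows R c S cell-R-c cell-R-c+1 cell-S R<S b_S<b_R with R ≟ i | R ≟ i⁺ | S ≟ i | S ≟ i⁺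
  ... | yes refl | _        | yes refl | _        = ⊥-elim (<-irrefl refl R<S)
  ... | yes refl | _        | no _     | yes refl =
    ⊥-elim (<-irrefl refl (<-trans shorter (subst₂ _<_ row-b-i⁺ row-b-i b_S<b_R)))
  ... | yes refl | _        | no S≢i   | no S≢i⁺  =
    typeI-i c S cell-R-c+1 cell-S (above-i R<S S≢i⁺) S≢i S≢i⁺
      (subst₂ _<_ (row-b-other′ S≢i S≢i⁺ cell-S) row-b-i b_S<b_R)
  ... | no _     | yes refl | yes refl | _        = ⊥-elim (<-irrefl refl (<-trans R<S i<i⁺))
  ... | no _     | yes refl | no _     | yes refl = ⊥-elim (<-irrefl refl R<S)
  ... | no _     | yes refl | no S≢i   | no S≢i⁺  =
    typeI-i⁺ c S cell-R-c+1 cell-S R<S S≢i S≢i⁺ (subst₂ _<_ (row-b-other′ S≢i S≢i⁺ cell-S) row-b-i⁺ b_S<b_R)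
  ... | no R≢i   | no R≢i⁺  | yes refl | _        =
    typeI-under-i c R cell-R-c cell-R-c+1 cell-S R<S R≢i R≢i⁺
      (subst₂ _<_ row-b-i (row-b-other′ R≢i R≢i⁺ cell-R-c) b_S<b_R)
  ... | no R≢i   | no R≢i⁺  | no _     | yes refl =
    typeI-under-i⁺ c R cell-R-c cell-R-c+1 cell-S (below-i⁺ R<S R≢i) R≢i R≢i⁺
      (subst₂ _<_ row-b-i⁺ (row-b-other′ R≢i R≢i⁺ cell-R-c) b_S<b_R)
  ... | no R≢i   | no R≢i⁺  | no S≢i   | no S≢i⁺  =
    trans (coinvB-cong 0 1 0 (U-other R≢i R≢i⁺ c) (U-other R≢i R≢i⁺ (suc c)) (U-other S≢i S≢i⁺ c))
      (T-typeI (b-cell-other R≢i R≢i⁺ cell-R-c) (b-cell-other R≢i R≢i⁺ cell-R-c+1) (b-cell-other S≢i S≢i⁺ cell-S) R<S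
        (subst₂ _<_ (row-b-other′ S≢i S≢i⁺ cell-S) (row-b-other′ R≢i R≢i⁺ cell-R-c) b_S<b_R))

  U-typeI : NoCoInvI n b U
  U-typeI R c S cell-R-c cell-R-c+1 cell-S R<S b_S<b_R =
    trans (coinvI-columns c (ent U R c) (ent U R (suc c)) (ent U S c))
      (typeI-by-rows R c S cell-R-c cell-R-c+1 cell-S R<S b_S<b_R)

  typeII-inner : ∀ c → Cell n b i (suc c) →
    coinvB (ent U i⁺ c) 0 (ent U i⁺ (suc c)) 1 (ent U i (suc c)) 1 ≡ false
  typeII-inner c cell-i-c+1 =
    trans (coinvB-cong 0 1 1 (U-row-i⁺-short (<⇒≤ c<aᵢ₊₁)) (U-row-i⁺-short c<aᵢ₊₁) (U-row-i (suc c)))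
      (inner-typeII (x c) (y c) (x (suc c)) (y (suc c)) (f c) (f (suc c)) (flag-step c))
    where
    c<aᵢ₊₁ = b-cell-i cell-i-c+1

  typeII-i : ∀ c S → Cell n b i (suc c) → Cell n b S (suc c) → S < i → S ≢ i → S ≢ i⁺ →
    row a S ≤ aᵢ₊₁ → coinvB (ent U i c) 0 (ent U i (suc c)) 1 (ent U S (suc c)) 1 ≡ false
  typeII-i c S cell-c+1 cell-S S<i S≢i S≢i⁺ a_S≤aᵢ₊₁ =
    trans (coinvB-cong 0 1 1 (U-row-i c) (U-row-i (suc c)) (U-other S≢i S≢i⁺ (suc c)))
      (typeII-row-i-over-other (x c) (y c) (x (suc c)) (y (suc c)) (ent T S (suc c)) (f c) (f (suc c)) (flag-step c)
        (T-typeII (cell-i-short (<⇒≤ c<aᵢ₊₁)) (cell-i-short c<aᵢ₊₁) cellᵀ-S S<i (≤-trans a_S≤aᵢ₊₁ aᵢ₊₁≤aᵢ))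
        (T-typeII (cell-i⁺ (<⇒≤ c<aᵢ₊₁)) (cell-i⁺ c<aᵢ₊₁) cellᵀ-S (<-trans S<i i<i⁺) a_S≤aᵢ₊₁))
    where
    c<aᵢ₊₁ = b-cell-i cell-c+1
    cellᵀ-S = b-cell-other S≢i S≢i⁺ cell-S

  typeII-i⁺ : ∀ c S → Cell n b i⁺ (suc c) → Cell n b S (suc c) → S < i → S ≢ i → S ≢ i⁺ →
    row a S ≤ aᵢ → coinvB (ent U i⁺ c) 0 (ent U i⁺ (suc c)) 1 (ent U S (suc c)) 1 ≡ false
  typeII-i⁺ c S cell-c+1 cell-S S<i S≢i S≢i⁺ a_S≤aᵢ with <-cmp c aᵢ₊₁
  ... | tri< c<aᵢ₊₁ _ _ =
    trans (coinvB-cong 0 1 1 (U-row-i⁺-short (<⇒≤ c<aᵢ₊₁)) (U-row-i⁺-short c<aᵢ₊₁) (U-other S≢i S≢i⁺ (suc c))) shape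
    where
    cellᵀ-S = b-cell-other S≢i S≢i⁺ cell-S
    cellᵀ-S-c : Cell n a S c
    cellᵀ-S-c = proj₁ cellᵀ-S , proj₁ (proj₂ cellᵀ-S) , <⇒≤ (proj₂ (proj₂ cellᵀ-S))
    x-triple = T-typeII (cell-i-short (<⇒≤ c<aᵢ₊₁)) (cell-i-short c<aᵢ₊₁) cellᵀ-S S<i a_S≤aᵢ
    shape : coinvB (if f c then y c else x c) 0 (if f (suc c) then y (suc c) else x (suc c)) 1 (ent T S (suc c)) 1 ≡ false
    shape with row a S ≤? aᵢ₊₁
    ... | yes a_S≤aᵢ₊₁ =
      typeII-row-i+1-over-short (x c) (y c) (x (suc c)) (y (suc c)) (ent T S (suc c)) (f c) (f (suc c)) (flag-step c)
        x-triple (T-typeII (cell-i⁺ (<⇒≤ c<aᵢ₊₁)) (cell-i⁺ c<aᵢ₊₁) cellᵀ-S (<-trans S<i i<i⁺) a_S≤aᵢ₊₁)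
    ... | no a_S≰aᵢ₊₁ =
      typeII-row-i+1-over-cyclic (x c) (y c) (x (suc c)) (y (suc c)) (ent T S c) (ent T S (suc c)) (f c) (f (suc c))
        (flag-step c) x-triple
        (T-typeI cellᵀ-S-c cellᵀ-S (cell-i⁺ (<⇒≤ c<aᵢ₊₁)) (<-trans S<i i<i⁺) (≰⇒> a_S≰aᵢ₊₁))
        (cyclic-below (proj₁ cellᵀ-S) S<i (≰⇒> a_S≰aᵢ₊₁) a_S≤aᵢ c (proj₂ (proj₂ cellᵀ-S-c)) (<⇒≤ c<aᵢ₊₁))
  ... | tri≈ _ refl _ =
    trans (coinvB-cong 0 1 1 (U-row-i⁺-short ≤-refl) (U-row-i⁺-long ≤-refl) (U-other S≢i S≢i⁺ (suc aᵢ₊₁)))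
      (typeII-row-i+1-over-end (x aᵢ₊₁) (y aᵢ₊₁) (x (suc aᵢ₊₁)) (ent T S aᵢ₊₁) (ent T S (suc aᵢ₊₁)) (f aᵢ₊₁)
        (T-typeII (cell-i aᵢ₊₁≤aᵢ) (cell-i (b-cell-i⁺ cell-c+1)) cellᵀ-S S<i a_S≤aᵢ)
        (T-typeI cellᵀ-S-c cellᵀ-S (cell-i⁺ ≤-refl) (<-trans S<i i<i⁺) (proj₂ (proj₂ cellᵀ-S)))
        (cyclic-below (proj₁ cellᵀ-S) S<i (proj₂ (proj₂ cellᵀ-S)) a_S≤aᵢ aᵢ₊₁ (proj₂ (proj₂ cellᵀ-S-c)) ≤-refl))
    where
    cellᵀ-S = b-cell-other S≢i S≢i⁺ cell-S
    cellᵀ-S-c : Cell n a S aᵢ₊₁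
    cellᵀ-S-c = proj₁ cellᵀ-S , proj₁ (proj₂ cellᵀ-S) , <⇒≤ (proj₂ (proj₂ cellᵀ-S))
  ... | tri> _ _ aᵢ₊₁<c =
    trans (coinvB-cong 0 1 1 (U-row-i⁺-long aᵢ₊₁<c) (U-row-i⁺-long (<-trans aᵢ₊₁<c ≤-refl)) (U-other S≢i S≢i⁺ (suc c)))
      (T-typeII (cell-i (<⇒≤ (b-cell-i⁺ cell-c+1))) (cell-i (b-cell-i⁺ cell-c+1)) (b-cell-other S≢i S≢i⁺ cell-S)
        S<i a_S≤aᵢ)

  typeII-over-i : ∀ c R → Cell n b R c → Cell n b R (suc c) → Cell n b i (suc c) → i⁺ < R → R ≢ i → R ≢ i⁺ →
    aᵢ₊₁ ≤ row a R → coinvB (ent U R c) 0 (ent U R (suc c)) 1 (ent U i (suc c)) 1 ≡ false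
  typeII-over-i c R cell-c cell-c+1 cell-i-c+1 i⁺<R R≢i R≢i⁺ aᵢ₊₁≤a_R =
    trans (coinvB-cong 0 1 1 (U-other R≢i R≢i⁺ c) (U-other R≢i R≢i⁺ (suc c)) (U-row-i (suc c))) shape
    where
    cellᵀ-c = b-cell-other R≢i R≢i⁺ cell-c
    cellᵀ-c+1 = b-cell-other R≢i R≢i⁺ cell-c+1
    c<aᵢ₊₁ = b-cell-i cell-i-c+1
    y-triple = T-typeII cellᵀ-c cellᵀ-c+1 (cell-i⁺ c<aᵢ₊₁) i⁺<R aᵢ₊₁≤a_R
    shape : coinvB (ent T R c) 0 (ent T R (suc c)) 1 (if f (suc c) then x (suc c) else y (suc c)) 1 ≡ false
    shape with aᵢ ≤? row a R
    ... | yes aᵢ≤a_R =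
      if-both (λ z → coinvB (ent T R c) 0 (ent T R (suc c)) 1 z 1 ≡ false) (f (suc c))
        (T-typeII cellᵀ-c cellᵀ-c+1 (cell-i-short c<aᵢ₊₁) (<-trans i<i⁺ i⁺<R) aᵢ≤a_R) y-triple
    ... | no aᵢ≰a_R =
      typeII-under-row-i-cyclic (x c) (y c) (x (suc c)) (y (suc c)) (ent T R c) (ent T R (suc c)) (f c) (f (suc c))
        (flag-step c)
        (T-typeI (cell-i-short (<⇒≤ c<aᵢ₊₁)) (cell-i-short c<aᵢ₊₁) cellᵀ-c (<-trans i<i⁺ i⁺<R) (≰⇒> aᵢ≰a_R))
        y-triple
        (cyclic-above (proj₁ (proj₂ cellᵀ-c)) i⁺<R aᵢ₊₁≤a_R (≰⇒> aᵢ≰a_R) c (proj₂ (proj₂ cellᵀ-c)) (<⇒≤ c<aᵢ₊₁))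

  typeII-over-i⁺ : ∀ c R → Cell n b R c → Cell n b R (suc c) → Cell n b i⁺ (suc c) → i⁺ < R → R ≢ i → R ≢ i⁺ →
    aᵢ ≤ row a R → coinvB (ent U R c) 0 (ent U R (suc c)) 1 (ent U i⁺ (suc c)) 1 ≡ false
  typeII-over-i⁺ c R cell-c cell-c+1 cell-i⁺-c+1 i⁺<R R≢i R≢i⁺ aᵢ≤a_R with suc c ≤? aᵢ₊₁
  ... | yes c<aᵢ₊₁ =
    trans (coinvB-cong 0 1 1 (U-other R≢i R≢i⁺ c) (U-other R≢i R≢i⁺ (suc c)) (U-row-i⁺-short c<aᵢ₊₁))
      (if-both (λ z → coinvB (ent T R c) 0 (ent T R (suc c)) 1 z 1 ≡ false) (f (suc c))
        (T-typeII cellᵀ-c cellᵀ-c+1 (cell-i⁺ c<aᵢ₊₁) i⁺<R (≤-trans aᵢ₊₁≤aᵢ aᵢ≤a_R))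
        (T-typeII cellᵀ-c cellᵀ-c+1 (cell-i (b-cell-i⁺ cell-i⁺-c+1)) (<-trans i<i⁺ i⁺<R) aᵢ≤a_R))
    where
    cellᵀ-c = b-cell-other R≢i R≢i⁺ cell-c
    cellᵀ-c+1 = b-cell-other R≢i R≢i⁺ cell-c+1
  ... | no c≮aᵢ₊₁ =
    trans (coinvB-cong 0 1 1 (U-other R≢i R≢i⁺ c) (U-other R≢i R≢i⁺ (suc c)) (U-row-i⁺-long (≰⇒> c≮aᵢ₊₁)))
      (T-typeII (b-cell-other R≢i R≢i⁺ cell-c) (b-cell-other R≢i R≢i⁺ cell-c+1) (cell-i (b-cell-i⁺ cell-i⁺-c+1))
        (<-trans i<i⁺ i⁺<R) aᵢ≤a_R)

  typeII-by-rows : ∀ R c S → Cell n b R c → Cell n b R (suc c) → Cell n b S (suc c) → S < R →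
    row b S ≤ row b R →
    coinvB (ent U R c) 0 (ent U R (suc c)) 1 (ent U S (suc c)) 1 ≡ false
  typeII-by-rows R c S cell-R-c cell-R-c+1 cell-S S<R b_S≤b_R with R ≟ i | R ≟ i⁺ | S ≟ i | S ≟ i⁺
  ... | yes refl | _        | yes refl | _        = ⊥-elim (<-irrefl refl S<R)
  ... | yes refl | _        | no _     | yes refl = ⊥-elim (<-irrefl refl (<-trans S<R i<i⁺))
  ... | yes refl | _        | no S≢i   | no S≢i⁺  =
    typeII-i c S cell-R-c+1 cell-S S<R S≢i S≢i⁺ (subst₂ _≤_ (row-b-other′ S≢i S≢i⁺ cell-S) row-b-i b_S≤b_R)
  ... | no _     | yes refl | yes refl | _        = typeII-inner c cell-S
  ... | no _     | yes refl | no _     | yes refl = ⊥-elim (<-irrefl refl S<R)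
  ... | no _     | yes refl | no S≢i   | no S≢i⁺  =
    typeII-i⁺ c S cell-R-c+1 cell-S (below-i⁺ S<R S≢i) S≢i S≢i⁺
      (subst₂ _≤_ (row-b-other′ S≢i S≢i⁺ cell-S) row-b-i⁺ b_S≤b_R)
  ... | no R≢i   | no R≢i⁺  | yes refl | _        =
    typeII-over-i c R cell-R-c cell-R-c+1 cell-S (above-i S<R R≢i⁺) R≢i R≢i⁺
      (subst₂ _≤_ row-b-i (row-b-other′ R≢i R≢i⁺ cell-R-c) b_S≤b_R)
  ... | no R≢i   | no R≢i⁺  | no _     | yes refl =
    typeII-over-i⁺ c R cell-R-c cell-R-c+1 cell-S S<R R≢i R≢i⁺
      (subst₂ _≤_ row-b-i⁺ (row-b-other′ R≢i R≢i⁺ cell-R-c) b_S≤b_R)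
  ... | no R≢i   | no R≢i⁺  | no S≢i   | no S≢i⁺  =
    trans (coinvB-cong 0 1 1 (U-other R≢i R≢i⁺ c) (U-other R≢i R≢i⁺ (suc c)) (U-other S≢i S≢i⁺ (suc c)))
      (T-typeII (b-cell-other R≢i R≢i⁺ cell-R-c) (b-cell-other R≢i R≢i⁺ cell-R-c+1) (b-cell-other S≢i S≢i⁺ cell-S) S<R
        (subst₂ _≤_ (row-b-other′ S≢i S≢i⁺ cell-S) (row-b-other′ R≢i R≢i⁺ cell-R-c) b_S≤b_R))

  U-typeII : NoCoInvII n b U
  U-typeII R c S cell-R-c cell-R-c+1 cell-S S<R b_S≤b_R =
    trans (coinvII-columns c (ent U R c) (ent U R (suc c)) (ent U S (suc c)))
      (typeII-by-rows R c S cell-R-c cell-R-c+1 cell-S S<R b_S≤b_R)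

  Swapped : ℕ → Set
  Swapped R = R ≡ i ⊎ R ≡ i⁺

  swapped? : ∀ R → Swapped R ⊎ (R ≢ i × R ≢ i⁺)
  swapped? R with R ≟ i | R ≟ i⁺
  ... | yes R≡i | _        = inj₁ (inj₁ R≡i)
  ... | no _    | yes R≡i⁺ = inj₁ (inj₂ R≡i⁺)
  ... | no R≢i  | no R≢i⁺  = inj₂ (R≢i , R≢i⁺)

  data Origin (R c : ℕ) : Set where
    origin : (ρ : ℕ) → Swapped ρ → Cell n a ρ c → ent U R c ≡ ent T ρ c → Origin R c

  origin-of : ∀ R c → Swapped R → Cell n b R c → Origin R c
  origin-of R c (inj₁ refl) cell with f c in fc
  ... | true  = origin i (inj₁ refl) (cell-i-short (b-cell-i cell)) (trans (U-row-i c) (if-then fc))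
  ... | false = origin i⁺ (inj₂ refl) (cell-i⁺ (b-cell-i cell)) (trans (U-row-i c) (if-else fc))
  origin-of R c (inj₂ refl) cell with c ≤? aᵢ₊₁
  ... | no c≰aᵢ₊₁ = origin i (inj₁ refl) (cell-i (b-cell-i⁺ cell)) (U-row-i⁺-long (≰⇒> c≰aᵢ₊₁))
  ... | yes c≤aᵢ₊₁ with f c in fc
  ...   | true  = origin i⁺ (inj₂ refl) (cell-i⁺ c≤aᵢ₊₁) (trans (U-row-i⁺-short c≤aᵢ₊₁) (if-then fc))
  ...   | false = origin i (inj₁ refl) (cell-i (b-cell-i⁺ cell)) (trans (U-row-i⁺-short c≤aᵢ₊₁) (if-else fc))

  U-entries : Entries n b U
  U-entries R zero    (_ , ())
  U-entries R (suc c) (cell , _) with swapped? R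
  ... | inj₁ R-swapped with origin-of R (suc c) R-swapped cell
  ...   | origin ρ _ cellᵀ U≡T =
    subst (λ e → 1 ≤ e × e ≤ n) (sym U≡T) (T-entries ρ (suc c) (cellᵀ , s≤s z≤n))
  U-entries R (suc c) (cell , _) | inj₂ (R≢i , R≢i⁺) =
    subst (λ e → 1 ≤ e × e ≤ n) (sym (U-other R≢i R≢i⁺ (suc c)))
      (T-entries R (suc c) (b-cell-other R≢i R≢i⁺ cell , s≤s z≤n))

  same-side : ∀ {R ρ σ} → R ≢ i → R ≢ i⁺ → Swapped ρ → Swapped σ →
    ((R ≡ᵇ ρ) ≡ (R ≡ᵇ σ)) × ((ρ <ᵇ R) ≡ (σ <ᵇ R)) × ((R <ᵇ ρ) ≡ (R <ᵇ σ))
  same-side {R} {ρ} {σ} R≢i R≢i⁺ ρ-swapped σ-swapped with <-cmp R i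
  ... | tri< R<i _ _ =
    trans (≡ᵇ-false (<⇒≢ (above ρ-swapped))) (sym (≡ᵇ-false (<⇒≢ (above σ-swapped)))) ,
    trans (<ᵇ-false (<⇒≤ (above ρ-swapped))) (sym (<ᵇ-false (<⇒≤ (above σ-swapped)))) ,
    trans (<ᵇ-true (above ρ-swapped)) (sym (<ᵇ-true (above σ-swapped)))
    where
    above : ∀ {τ} → Swapped τ → R < τ
    above (inj₁ refl) = R<i
    above (inj₂ refl) = <-trans R<i i<i⁺
  ... | tri≈ _ R≡i _ = ⊥-elim (R≢i R≡i)
  ... | tri> _ _ i<R =
    trans (≡ᵇ-false (>⇒≢ (below ρ-swapped))) (sym (≡ᵇ-false (>⇒≢ (below σ-swapped)))) ,
    trans (<ᵇ-true (below ρ-swapped)) (sym (<ᵇ-true (below σ-swapped))) ,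
    trans (<ᵇ-false (<⇒≤ (below ρ-swapped))) (sym (<ᵇ-false (<⇒≤ (below σ-swapped))))
    where
    below : ∀ {τ} → Swapped τ → τ < R
    below (inj₁ refl) = i<R
    below (inj₂ refl) = above-i i<R R≢i⁺

  swapped-rows-nonattacking : ∀ c₁ c₂ → Cell n b i c₁ → Cell n b i⁺ c₂ →
    attackB i c₁ (ent U i c₁) i⁺ c₂ (ent U i⁺ c₂) ≡ false
  swapped-rows-nonattacking c₁ c₂ cell₁ cell₂ = attackB-false i c₁ (ent U i c₁) i⁺ c₂ (ent U i⁺ c₂) same next prev
    where
    same : c₁ ≡ c₂ → i ≢ i⁺ → (ent U i c₁ ≡ᵇ ent U i⁺ c₂) ≡ false
    same refl _ =
      trans (cong₂ _≡ᵇ_ (U-row-i c₁) (U-row-i⁺-short (b-cell-i cell₁)))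
        (if-swap-distinct (f c₁) (T-column-distinct (cell-i-short (b-cell-i cell₁)) (cell-i⁺ (b-cell-i cell₁)) i≢i⁺))
    next : c₂ ≡ suc c₁ → i⁺ < i → (ent U i c₁ ≡ᵇ ent U i⁺ c₂) ≡ false
    next _ i⁺<i = ⊥-elim (<-irrefl refl (<-trans i⁺<i i<i⁺))
    prev : c₁ ≡ suc c₂ → i < i⁺ → (ent U i c₁ ≡ᵇ ent U i⁺ c₂) ≡ false
    prev refl _ =
      trans (≡ᵇ-sym (ent U i (suc c₂)) (ent U i⁺ c₂))
        (trans (cong₂ _≡ᵇ_ (U-row-i⁺-short (<⇒≤ (b-cell-i cell₁))) (U-row-i (suc c₂)))
          (diagonal-distinct (x c₂) (y c₂) (x (suc c₂)) (y (suc c₂)) (f c₂) (f (suc c₂)) (flag-step c₂)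
            (T-column-distinct (cell-i-short (b-cell-i cell₁)) (cell-i⁺ (b-cell-i cell₁)) i≢i⁺)))

  U-nonattacking : NonAttacking n b U
  U-nonattacking R₁ c₁ R₂ c₂ cell₁ cell₂ with swapped? R₁ | swapped? R₂
  ... | inj₁ (inj₁ refl) | inj₁ (inj₁ refl) = attackB-same-row i c₁ (ent U i c₁) c₂ (ent U i c₂)
  ... | inj₁ (inj₂ refl) | inj₁ (inj₂ refl) = attackB-same-row i⁺ c₁ (ent U i⁺ c₁) c₂ (ent U i⁺ c₂)
  ... | inj₁ (inj₁ refl) | inj₁ (inj₂ refl) = swapped-rows-nonattacking c₁ c₂ cell₁ cell₂
  ... | inj₁ (inj₂ refl) | inj₁ (inj₁ refl) =
    trans (attackB-sym i⁺ c₁ (ent U i⁺ c₁) i c₂ (ent U i c₂)) (swapped-rows-nonattacking c₂ c₁ cell₂ cell₁)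
  ... | inj₁ R₁-swapped | inj₂ (R₂≢i , R₂≢i⁺) with origin-of R₁ c₁ R₁-swapped cell₁
  ...   | origin ρ ρ-swapped cellᵀ U≡T with same-side R₂≢i R₂≢i⁺ ρ-swapped R₁-swapped
  ...     | ≡-same , <-same , >-same rewrite U≡T | U-other R₂≢i R₂≢i⁺ c₂ =
    trans (attackB-rows R₁ R₂ ρ R₂ c₁ (ent T ρ c₁) c₂ (ent T R₂ c₂)
            (trans (≡ᵇ-sym R₁ R₂) (trans (sym ≡-same) (≡ᵇ-sym R₂ ρ))) (sym >-same) (sym <-same))
      (T-nonattacking ρ c₁ R₂ c₂ cellᵀ (b-cell-other R₂≢i R₂≢i⁺ cell₂))
  U-nonattacking R₁ c₁ R₂ c₂ cell₁ cell₂ | inj₂ (R₁≢i , R₁≢i⁺) | inj₁ R₂-swapped with origin-of R₂ c₂ R₂-swapped cell₂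
  ...   | origin ρ ρ-swapped cellᵀ U≡T with same-side R₁≢i R₁≢i⁺ ρ-swapped R₂-swapped
  ...     | ≡-same , <-same , >-same rewrite U≡T | U-other R₁≢i R₁≢i⁺ c₁ =
    trans (attackB-rows R₁ R₂ R₁ ρ c₁ (ent T R₁ c₁) c₂ (ent T ρ c₂) (sym ≡-same) (sym <-same) (sym >-same))
      (T-nonattacking R₁ c₁ ρ c₂ (b-cell-other R₁≢i R₁≢i⁺ cell₁) cellᵀ)
  U-nonattacking R₁ c₁ R₂ c₂ cell₁ cell₂ | inj₂ (R₁≢i , R₁≢i⁺) | inj₂ (R₂≢i , R₂≢i⁺)
    rewrite U-other R₁≢i R₁≢i⁺ c₁ | U-other R₂≢i R₂≢i⁺ c₂ =
    T-nonattacking R₁ c₁ R₂ c₂ (b-cell-other R₁≢i R₁≢i⁺ cell₁) (b-cell-other R₂≢i R₂≢i⁺ cell₂)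

  Ei-sskd : SSKD n b U
  Ei-sskd = U-entries , U-nonattacking , U-typeI , U-typeII

module E0Proof (n : ℕ) (a : Vec ℕ n) (T : Filling) (T-sskd : SSKD n a T)
  (2≤n : 2 ≤ n) (a₁≤aₙ : row a 1 ≤ row a n) (a₁>0 : 0 < row a 1) where

  open Predicates
  open E0Patterns
  open SSKDFacts T-sskd

  a₁ aₙ : ℕ
  a₁ = row a 1
  aₙ = row a n

  x y : ℕ → ℕ
  x c = ent T 1 c
  y c = ent T n c

  f : ℕ → Bool
  f = flag0 n a T

  U : Filling
  U = E0 n a T

  b : Vec ℕ n
  b = sAct n zero a

  1<n : 1 < n
  1<n = 2≤n

  1≤n : 1 ≤ n
  1≤n = <⇒≤ 1<n

  1≢n : 1 ≢ n
  1≢n = <⇒≢ 1<n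

  row-b : ∀ R → 1 ≤ R → R ≤ n →
    row b R ≡ (if R ≡ᵇ 1 then row a n + 1 else if R ≡ᵇ n then row a 1 ∸ 1 else row a R)
  row-b = row-tabulate n (λ R → if R ≡ᵇ 1 then row a n + 1 else if R ≡ᵇ n then row a 1 ∸ 1 else row a R)

  row-b-1 : row b 1 ≡ aₙ + 1
  row-b-1 = row-b 1 ≤-refl 1≤n

  row-b-n : row b n ≡ a₁ ∸ 1
  row-b-n = trans (row-b n 1≤n ≤-refl) (trans (if-else (≡ᵇ-false (>⇒≢ 1<n))) (if-then (≡ᵇ-true {n} refl)))

  row-b-other : ∀ {R} → 1 ≤ R → R ≤ n → R ≢ 1 → R ≢ n → row b R ≡ row a R
  row-b-other {R} 1≤R R≤n R≢1 R≢n =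
    trans (row-b R 1≤R R≤n) (trans (if-else (≡ᵇ-false R≢1)) (if-else (≡ᵇ-false R≢n)))

  U-row-1 : ∀ c → ent U 1 c ≡ (if c ≤ᵇ a₁ then (if f c then x c else y (c ∸ 1)) else y (c ∸ 1))
  U-row-1 zero    = refl
  U-row-1 (suc c) = refl

  U-row-1-short : ∀ c → suc c ≤ a₁ → ent U 1 (suc c) ≡ (if f (suc c) then x (suc c) else y c)
  U-row-1-short c c<a₁ = trans (U-row-1 (suc c)) (if-then (≤ᵇ-true c<a₁))

  U-row-1-long : ∀ c → a₁ < suc c → ent U 1 (suc c) ≡ y c
  U-row-1-long c a₁≤c = trans (U-row-1 (suc c)) (if-else (≤ᵇ-false a₁≤c))

  U-row-1-first : ent U 1 1 ≡ x 1
  U-row-1-first = U-row-1-short 0 a₁>0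

  U-row-n : ∀ c → ent U n c ≡ (if f (suc c) then y c else x (suc c))
  U-row-n zero    = refl
  U-row-n (suc c) = trans (if-else (≡ᵇ-false (>⇒≢ 1<n))) (if-then (≡ᵇ-true {n} refl))

  U-other : ∀ {R} → R ≢ 1 → R ≢ n → ∀ c → ent U R c ≡ ent T R c
  U-other R≢1 R≢n zero    = refl
  U-other R≢1 R≢n (suc c) = trans (if-else (≡ᵇ-false R≢1)) (if-else (≡ᵇ-false R≢n))

  clash-columns : ∀ k α β γ →
    (coinvB α k β (suc k) γ k ∨ attackB 1 k α 1 (suc k) β ∨ attackB 1 k α n k γ ∨ attackB 1 (suc k) β n k γ)
      ≡ clash α β γ
  clash-columns k α β γ =
    cong₂ _∨_ (coinvI-columns k α β γ)
      (cong₂ _∨_ (attackB-same-row 1 k α (suc k) β)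
        (cong₂ _∨_ (attackB-same-column 1 n k α γ 1≢n) (attackB-next-column′ 1 n k β γ 1<n)))

  flag-step : ∀ k → f (suc (suc k)) ≡ nextFlag0 (f (suc k)) (y k) (x (suc k)) (y (suc k)) (x (suc (suc k)))
  flag-step k =
    trans (cong₂ (λ u v → if f (suc k) then (if u then false else true) else (if v then true else false))
            (clash-columns (suc k) (x (suc k)) (x (suc (suc k))) (y (suc k)))
            (clash-columns (suc k) (y k) (y (suc k)) (x (suc (suc k)))))
      (cong₂ (λ u v → if f (suc k) then u else v)
        (if-false-true (clash (x (suc k)) (x (suc (suc k))) (y (suc k))))
        (if-true-false (clash (y k) (y (suc k)) (x (suc (suc k))))))

  x₁≡1 : x 1 ≡ 1
  x₁≡1 = column-one-row-one a₁>0 1≤n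

  cell-1 : ∀ {c} → c ≤ a₁ → Cell n a 1 c
  cell-1 c≤a₁ = s≤s z≤n , 1≤n , c≤a₁

  cell-n : ∀ {c} → c ≤ aₙ → Cell n a n c
  cell-n c≤aₙ = 1≤n , ≤-refl , c≤aₙ

  ≤aₙ : ∀ {c} → c ≤ a₁ → c ≤ aₙ
  ≤aₙ c≤a₁ = ≤-trans c≤a₁ a₁≤aₙ

  record Middle (R : ℕ) : Set where
    field
      above-1 : 1 < R
      below-n : R < n
  open Middle

  cell-mid : ∀ {R c} → Middle R → c ≤ row a R → Cell n a R c
  cell-mid R-mid c≤a_R = <⇒≤ (above-1 R-mid) , <⇒≤ (below-n R-mid) , c≤a_R

  mid≢1 : ∀ {R} → Middle R → R ≢ 1
  mid≢1 R-mid = >⇒≢ (above-1 R-mid)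

  mid≢n : ∀ {R} → Middle R → R ≢ n
  mid≢n R-mid = <⇒≢ (below-n R-mid)

  -- The invariant behind E_0: while x stays in row 1 (f (k+1)), the entries T R (k+1), y (k+1),
  -- x (k+1) of a middle row R of intermediate length are cyclically ordered.

  cyclic-middle : ∀ {R} → Middle R → a₁ ≤ row a R → row a R ≤ aₙ → ∀ k → suc k ≤ row a R → suc k ≤ a₁ →
    (if f (suc k) then coinvB (ent T R (suc k)) 0 (y (suc k)) 0 (x (suc k)) 0 else true) ≡ true
  cyclic-middle {R} R-mid a₁≤a_R a_R≤aₙ zero 0<a_R 0<a₁ =
    cyclic-start 1 n (x 1) (y 1) (ent T R 1) (≡ᵇ-true x₁≡1)
      (ltB-right-column (proj₁ (T-entry-bounds (cell-mid R-mid 0<a_R))))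
      (ltB-right-column (proj₂ (T-entry-bounds (cell-mid R-mid 0<a_R))))
      (T-column-distinct (cell-1 0<a₁) (cell-mid R-mid 0<a_R) (≢-sym (mid≢1 R-mid)))
      (T-column-distinct (cell-n (≤aₙ 0<a₁)) (cell-mid R-mid 0<a_R) (≢-sym (mid≢n R-mid)))
      (T-typeII (cell-n z≤n) (cell-n (≤aₙ 0<a₁)) (cell-mid R-mid 0<a_R) (below-n R-mid) a_R≤aₙ)
  cyclic-middle {R} R-mid a₁≤a_R a_R≤aₙ (suc k) k+1<a_R k+1<a₁ =
    cyclic-step (y k) (x c) (y c) (x c⁺) (y c⁺) (ent T R c) (ent T R c⁺) (f c) (f c⁺) (flag-step k)
      (cyclic-middle R-mid a₁≤a_R a_R≤aₙ k (<⇒≤ k+1<a_R) (<⇒≤ k+1<a₁))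
      (T-typeII (cell-mid R-mid (<⇒≤ k+1<a_R)) (cell-mid R-mid k+1<a_R) (cell-1 k+1<a₁) (above-1 R-mid) a₁≤a_R)
      (T-typeII (cell-n (≤aₙ (<⇒≤ k+1<a₁))) (cell-n (≤aₙ k+1<a₁)) (cell-mid R-mid k+1<a_R) (below-n R-mid) a_R≤aₙ)
      (T-typeII (cell-n (≤aₙ (<⇒≤ (<⇒≤ k+1<a₁)))) (cell-n (≤aₙ (<⇒≤ k+1<a₁))) (cell-mid R-mid (<⇒≤ k+1<a_R))
        (below-n R-mid) a_R≤aₙ)
      (T-column-distinct (cell-1 k+1<a₁) (cell-mid R-mid k+1<a_R) (≢-sym (mid≢1 R-mid)))
      (T-column-distinct (cell-1 k+1<a₁) (cell-n (≤aₙ k+1<a₁)) 1≢n)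
      (T-column-distinct (cell-n (≤aₙ k+1<a₁)) (cell-mid R-mid k+1<a_R) (≢-sym (mid≢n R-mid)))
    where
    c = suc k
    c⁺ = suc (suc k)

  <a₁ : ∀ {c} → c ≤ a₁ ∸ 1 → suc c ≤ a₁
  <a₁ = shift a₁>0
    where
    shift : ∀ {c z} → 0 < z → c ≤ z ∸ 1 → suc c ≤ z
    shift {z = suc z} _ c≤z = s≤s c≤z

  ≤aₙ+1 : ∀ {c} → suc c ≤ aₙ + 1 → c ≤ aₙ
  ≤aₙ+1 {c} c<aₙ+1 = ≤-pred (subst (suc c ≤_) (+-comm aₙ 1) c<aₙ+1)

  typeI-window : ∀ c → c ≤ a₁ ∸ 1 → coinvB (ent U 1 c) 0 (ent U 1 (suc c)) 1 (ent U n c) 0 ≡ false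
  typeI-window zero _ = trans (cong (λ β → coinvB 1 0 β 1 n 0) U-row-1-first) (typeI-start 1 n (x 1) (≡ᵇ-true x₁≡1))
  typeI-window (suc k) k+1<a₁∸1 =
    trans (coinvB-cong 0 1 0 (U-row-1-short k (<⇒≤ k+2≤a₁)) (U-row-1-short (suc k) k+2≤a₁) (U-row-n (suc k)))
      (window-typeI (y k) (x (suc k)) (y (suc k)) (x (suc (suc k))) (f (suc k)) (f (suc (suc k))) (flag-step k)
        (T-diagonal-distinct (cell-n (≤aₙ (<⇒≤ k+2≤a₁))) (cell-1 k+2≤a₁) 1<n))
    where k+2≤a₁ = <a₁ k+1<a₁∸1

  window-column-distinct : ∀ c → c ≤ a₁ ∸ 1 → (ent U 1 c ≡ᵇ ent U n c) ≡ false
  window-column-distinct zero _ = ≡ᵇ-false 1≢n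
  window-column-distinct (suc k) k+1<a₁∸1 =
    trans (cong₂ _≡ᵇ_ (U-row-1-short k (<⇒≤ k+2≤a₁)) (U-row-n (suc k)))
      (window-distinct (y k) (x (suc k)) (y (suc k)) (x (suc (suc k))) (f (suc k)) (f (suc (suc k))) (flag-step k)
        (T-diagonal-distinct (cell-n (≤aₙ (<⇒≤ k+2≤a₁))) (cell-1 k+2≤a₁) 1<n))
    where k+2≤a₁ = <a₁ k+1<a₁∸1

  window-diagonal-distinct : ∀ c → c ≤ a₁ ∸ 1 → (ent U n c ≡ᵇ ent U 1 (suc c)) ≡ false
  window-diagonal-distinct c c≤a₁∸1 =
    trans (cong₂ _≡ᵇ_ (U-row-n c) (U-row-1-short c c<a₁))
      (if-swap-distinct (f (suc c)) (T-diagonal-distinct (cell-n (≤aₙ (<⇒≤ c<a₁))) (cell-1 c<a₁) 1<n))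
    where c<a₁ = <a₁ c≤a₁∸1

  typeI-row-1 : ∀ {R} → Middle R → ∀ c → c ≤ row a R → row a R ≤ aₙ → suc c ≤ aₙ + 1 →
    coinvB (ent U 1 c) 0 (ent U 1 (suc c)) 1 (ent T R c) 0 ≡ false
  typeI-row-1 {R} R-mid zero _ _ _ =
    trans (cong (λ β → coinvB 1 0 β 1 R 0) U-row-1-first) (typeI-start 1 R (x 1) (≡ᵇ-true x₁≡1))
  typeI-row-1 {R} R-mid (suc k) k+1≤a_R a_R≤aₙ _ with suc (suc k) ≤? a₁
  ... | yes k+2≤a₁ =
    trans (cong₂ (λ α β → coinvB α 0 β 1 (ent T R (suc k)) 0) (U-row-1-short k (<⇒≤ k+2≤a₁)) (U-row-1-short (suc k) k+2≤a₁)) shape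
    where
    y-triple = T-typeII (cell-n (≤aₙ (<⇒≤ (<⇒≤ k+2≤a₁)))) (cell-n (≤aₙ (<⇒≤ k+2≤a₁))) (cell-mid R-mid k+1≤a_R)
                 (below-n R-mid) a_R≤aₙ
    y≢T = T-column-distinct (cell-n (≤aₙ (<⇒≤ k+2≤a₁))) (cell-mid R-mid k+1≤a_R) (≢-sym (mid≢n R-mid))
    shape : coinvB (if f (suc k) then x (suc k) else y k) 0 (if f (suc (suc k)) then x (suc (suc k)) else y (suc k)) 1
              (ent T R (suc k)) 0 ≡ false
    shape with row a R <? a₁
    ... | yes a_R<a₁ =
      typeI-row-1-under-short (y k) (x (suc k)) (y (suc k)) (x (suc (suc k))) (ent T R (suc k)) (f (suc k)) (f (suc (suc k)))
        (flag-step k) (T-typeI (cell-1 (<⇒≤ k+2≤a₁)) (cell-1 k+2≤a₁) (cell-mid R-mid k+1≤a_R) (above-1 R-mid) a_R<a₁)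
        y-triple y≢T
    ... | no a_R≮a₁ =
      typeI-row-1-under-cyclic (y k) (x (suc k)) (y (suc k)) (x (suc (suc k))) (ent T R (suc k)) (f (suc k)) (f (suc (suc k)))
        (flag-step k) (cyclic-middle R-mid (≮⇒≥ a_R≮a₁) a_R≤aₙ k k+1≤a_R (<⇒≤ k+2≤a₁)) y-triple y≢T
  ... | no k+2≰a₁ with suc k ≤? a₁
  ...   | yes k+1≤a₁ =
    trans (cong₂ (λ α β → coinvB α 0 β 1 (ent T R (suc k)) 0) (U-row-1-short k k+1≤a₁) (U-row-1-long (suc k) (≰⇒> k+2≰a₁)))
      (typeI-row-1-under-end (y k) (x (suc k)) (y (suc k)) (ent T R (suc k)) (f (suc k))
        (cyclic-middle R-mid (≤-trans (≤-pred (≰⇒> k+2≰a₁)) k+1≤a_R) a_R≤aₙ k k+1≤a_R k+1≤a₁)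
        (T-typeII (cell-n (≤aₙ (<⇒≤ k+1≤a₁))) (cell-n (≤aₙ k+1≤a₁)) (cell-mid R-mid k+1≤a_R) (below-n R-mid) a_R≤aₙ)
        (T-column-distinct (cell-n (≤aₙ k+1≤a₁)) (cell-mid R-mid k+1≤a_R) (≢-sym (mid≢n R-mid))))
  ...   | no k+1≰a₁ =
    trans (cong₂ (λ α β → coinvB α 0 β 1 (ent T R (suc k)) 0) (U-row-1-long k (≰⇒> k+1≰a₁)) (U-row-1-long (suc k) (≰⇒> k+2≰a₁)))
      (typeI-row-1-under-beyond (y k) (y (suc k)) (ent T R (suc k))
        (T-typeII (cell-n (<⇒≤ (≤-trans k+1≤a_R a_R≤aₙ))) (cell-n (≤-trans k+1≤a_R a_R≤aₙ)) (cell-mid R-mid k+1≤a_R)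
          (below-n R-mid) a_R≤aₙ)
        (T-column-distinct (cell-n (≤-trans k+1≤a_R a_R≤aₙ)) (cell-mid R-mid k+1≤a_R) (≢-sym (mid≢n R-mid))))

  typeI-row-n : ∀ {R} → Middle R → ∀ c → suc c ≤ row a R → a₁ ≤ row a R → c ≤ a₁ ∸ 1 →
    coinvB (ent T R c) 0 (ent T R (suc c)) 1 (ent U n c) 0 ≡ false
  typeI-row-n {R} R-mid zero 0<a_R _ _ =
    typeI-over-row-n-start R n (ent T R 1) (ltB-same-column (below-n R-mid))
      (ltB-right-column (column-one-≤-row (cell-mid R-mid 0<a_R)))
  typeI-row-n {R} R-mid (suc k) k+1<a_R a₁≤a_R k+1≤a₁∸1 =
    trans (cong (λ γ → coinvB (ent T R (suc k)) 0 (ent T R (suc (suc k))) 1 γ 0) (U-row-n (suc k))) shape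
    where
    k+2≤a₁ = <a₁ k+1≤a₁∸1
    x-triple = T-typeII (cell-mid R-mid (<⇒≤ k+1<a_R)) (cell-mid R-mid k+1<a_R) (cell-1 k+2≤a₁) (above-1 R-mid) a₁≤a_R
    x≢T = T-column-distinct (cell-1 k+2≤a₁) (cell-mid R-mid k+1<a_R) (≢-sym (mid≢1 R-mid))
    shape : coinvB (ent T R (suc k)) 0 (ent T R (suc (suc k))) 1 (if f (suc (suc k)) then y (suc k) else x (suc (suc k))) 0
              ≡ false
    shape with row a R ≤? aₙ
    ... | no a_R≰aₙ =
      typeI-over-row-n-long (y (suc k)) (x (suc (suc k))) (ent T R (suc k)) (ent T R (suc (suc k))) (f (suc (suc k)))
        (T-typeI (cell-mid R-mid (<⇒≤ k+1<a_R)) (cell-mid R-mid k+1<a_R) (cell-n (≤aₙ (<⇒≤ k+2≤a₁))) (below-n R-mid)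
          (≰⇒> a_R≰aₙ))
        x-triple x≢T
    ... | yes a_R≤aₙ =
      typeI-over-row-n-cyclic (y k) (x (suc k)) (y (suc k)) (x (suc (suc k))) (ent T R (suc k)) (ent T R (suc (suc k)))
        (f (suc k)) (f (suc (suc k))) (flag-step k)
        (cyclic-middle R-mid a₁≤a_R a_R≤aₙ k (<⇒≤ k+1<a_R) (<⇒≤ k+2≤a₁)) x-triple
        (T-typeII (cell-n (≤aₙ (<⇒≤ (<⇒≤ k+2≤a₁)))) (cell-n (≤aₙ (<⇒≤ k+2≤a₁))) (cell-mid R-mid (<⇒≤ k+1<a_R))
          (below-n R-mid) a_R≤aₙ)
        x≢T

  typeII-row-1 : ∀ {R} → Middle R → ∀ c → suc c ≤ row a R → aₙ + 1 ≤ row a R → suc c ≤ aₙ + 1 →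
    coinvB (ent T R c) 0 (ent T R (suc c)) 1 (ent U 1 (suc c)) 1 ≡ false
  typeII-row-1 {R} R-mid zero 0<a_R _ _ =
    trans (cong (λ γ → coinvB R 0 (ent T R 1) 1 γ 1) U-row-1-first)
      (typeII-under-row-1-start 1 R (x 1) (ent T R 1) (≡ᵇ-true x₁≡1)
        (ltB-right-column (column-one-≤-row (cell-mid R-mid 0<a_R)))
        (ltB-right-column (proj₁ (T-entry-bounds (cell-mid R-mid 0<a_R)))))
  typeII-row-1 {R} R-mid (suc k) k+1<a_R aₙ+1≤a_R k+1≤aₙ+1 = by-position (suc (suc k) ≤? a₁)
    where
    k+1≤aₙ = ≤aₙ+1 k+1≤aₙ+1
    aₙ<a_R : aₙ < row a R
    aₙ<a_R = subst (_≤ row a R) (+-comm aₙ 1) aₙ+1≤a_R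
    y-triple = T-typeI (cell-mid R-mid (<⇒≤ k+1<a_R)) (cell-mid R-mid k+1<a_R) (cell-n k+1≤aₙ) (below-n R-mid) aₙ<a_R
    y≢T = T-column-distinct (cell-n k+1≤aₙ) (cell-mid R-mid (<⇒≤ k+1<a_R)) (≢-sym (mid≢n R-mid))
    by-position : Dec (suc (suc k) ≤ a₁) →
      coinvB (ent T R (suc k)) 0 (ent T R (suc (suc k))) 1 (ent U 1 (suc (suc k))) 1 ≡ false
    by-position (yes k+2≤a₁) =
      trans (cong (λ γ → coinvB (ent T R (suc k)) 0 (ent T R (suc (suc k))) 1 γ 1) (U-row-1-short (suc k) k+2≤a₁))
        (typeII-under-row-1-inside (y (suc k)) (x (suc (suc k))) (ent T R (suc k)) (ent T R (suc (suc k)))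
          (f (suc (suc k))) y-triple
          (T-typeII (cell-mid R-mid (<⇒≤ k+1<a_R)) (cell-mid R-mid k+1<a_R) (cell-1 k+2≤a₁) (above-1 R-mid)
            (≤-trans a₁≤aₙ (<⇒≤ aₙ<a_R)))
          y≢T)
    by-position (no k+2≰a₁) =
      trans (cong (λ γ → coinvB (ent T R (suc k)) 0 (ent T R (suc (suc k))) 1 γ 1) (U-row-1-long (suc k) (≰⇒> k+2≰a₁)))
        (typeII-under-row-1-beyond (y (suc k)) (ent T R (suc k)) (ent T R (suc (suc k))) y-triple y≢T)

  typeII-row-n : ∀ {R} → Middle R → ∀ c → suc c ≤ row a R → row a R ≤ a₁ ∸ 1 → suc c ≤ a₁ ∸ 1 →
    coinvB (ent U n c) 0 (ent U n (suc c)) 1 (ent T R (suc c)) 1 ≡ false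
  typeII-row-n {R} R-mid c c<a_R a_R≤a₁∸1 c<a₁∸1 =
    trans (cong₂ (λ α β → coinvB α 0 β 1 (ent T R (suc c)) 1) (U-row-n c) (U-row-n (suc c))) (shape c c<a_R c<a₁∸1)
    where
    a_R<a₁ = <a₁ a_R≤a₁∸1
    a_R≤aₙ = ≤-trans (<⇒≤ a_R<a₁) a₁≤aₙ
    shape : ∀ c → suc c ≤ row a R → suc c ≤ a₁ ∸ 1 →
      coinvB (if f (suc c) then y c else x (suc c)) 0 (if f (suc (suc c)) then y (suc c) else x (suc (suc c))) 1
        (ent T R (suc c)) 1 ≡ false
    shape zero 0<a_R 1≤a₁∸1 =
      typeII-row-n-over-start n (x 1) (y 1) (ent T R 1) (x 2) (f 2)
        (T-column-distinct (cell-n (≤aₙ (<⇒≤ 2≤a₁))) (cell-mid R-mid 0<a_R) (≢-sym (mid≢n R-mid)))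
        (T-typeII (cell-n z≤n) (cell-n (≤aₙ (<⇒≤ 2≤a₁))) (cell-mid R-mid 0<a_R) (below-n R-mid) a_R≤aₙ)
        (T-typeI (cell-1 (<⇒≤ 2≤a₁)) (cell-1 2≤a₁) (cell-mid R-mid 0<a_R) (above-1 R-mid) a_R<a₁)
        (flag-step 0)
      where 2≤a₁ = <a₁ 1≤a₁∸1
    shape (suc k) k+1<a_R k+2≤a₁∸1 =
      typeII-row-n-over (y (suc k)) (x (suc (suc k))) (y (suc (suc k))) (x (suc (suc (suc k)))) (ent T R (suc (suc k)))
        (f (suc (suc k))) (f (suc (suc (suc k)))) (flag-step (suc k))
        (T-typeI (cell-1 (<⇒≤ k+3≤a₁)) (cell-1 k+3≤a₁) (cell-mid R-mid k+1<a_R) (above-1 R-mid) a_R<a₁)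
        (T-typeII (cell-n (≤aₙ (<⇒≤ (<⇒≤ k+3≤a₁)))) (cell-n (≤aₙ (<⇒≤ k+3≤a₁))) (cell-mid R-mid k+1<a_R) (below-n R-mid)
          a_R≤aₙ)
        (T-column-distinct (cell-1 (<⇒≤ k+3≤a₁)) (cell-mid R-mid k+1<a_R) (≢-sym (mid≢1 R-mid)))
      where k+3≤a₁ = <a₁ k+2≤a₁∸1

  mid-vs-row-1 : ∀ {R} → Middle R → ∀ c → c ≤ row a R → c ≤ aₙ + 1 → (ent T R c ≡ᵇ ent U 1 c) ≡ false
  mid-vs-row-1 {R} R-mid zero    _ _ = ≡ᵇ-false (mid≢1 R-mid)
  mid-vs-row-1 {R} R-mid (suc k) k<a_R k<aₙ+1 with suc k ≤? a₁
  ... | yes k<a₁ =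
    trans (cong (ent T R (suc k) ≡ᵇ_) (U-row-1-short k k<a₁))
      (if-both (λ e → (ent T R (suc k) ≡ᵇ e) ≡ false) (f (suc k))
        (T-column-distinct (cell-mid R-mid k<a_R) (cell-1 k<a₁) (mid≢1 R-mid))
        (≢ᵇ-sym (y k) (ent T R (suc k)) (T-diagonal-distinct (cell-n (≤aₙ (<⇒≤ k<a₁))) (cell-mid R-mid k<a_R) (below-n R-mid))))
  ... | no k≮a₁ =
    trans (cong (ent T R (suc k) ≡ᵇ_) (U-row-1-long k (≰⇒> k≮a₁)))
      (≢ᵇ-sym (y k) (ent T R (suc k)) (T-diagonal-distinct (cell-n (≤aₙ+1 k<aₙ+1)) (cell-mid R-mid k<a_R) (below-n R-mid)))

  mid-vs-row-1-next : ∀ {R} → Middle R → ∀ c → c ≤ row a R → suc c ≤ aₙ + 1 →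
    (ent T R c ≡ᵇ ent U 1 (suc c)) ≡ false
  mid-vs-row-1-next {R} R-mid c c≤a_R c<aₙ+1 with suc c ≤? a₁
  ... | yes c<a₁ =
    trans (cong (ent T R c ≡ᵇ_) (U-row-1-short c c<a₁))
      (if-both (λ e → (ent T R c ≡ᵇ e) ≡ false) (f (suc c))
        (T-diagonal-distinct (cell-mid R-mid c≤a_R) (cell-1 c<a₁) (above-1 R-mid))
        (T-column-distinct (cell-mid R-mid c≤a_R) (cell-n (≤aₙ (<⇒≤ c<a₁))) (mid≢n R-mid)))
  ... | no c≮a₁ =
    trans (cong (ent T R c ≡ᵇ_) (U-row-1-long c (≰⇒> c≮a₁)))
      (T-column-distinct (cell-mid R-mid c≤a_R) (cell-n (≤aₙ+1 c<aₙ+1)) (mid≢n R-mid))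

  mid-vs-row-n : ∀ {R} → Middle R → ∀ c → c ≤ row a R → c ≤ a₁ ∸ 1 → (ent T R c ≡ᵇ ent U n c) ≡ false
  mid-vs-row-n {R} R-mid c c≤a_R c≤a₁∸1 =
    trans (cong (ent T R c ≡ᵇ_) (U-row-n c))
      (if-both (λ e → (ent T R c ≡ᵇ e) ≡ false) (f (suc c))
        (T-column-distinct (cell-mid R-mid c≤a_R) (cell-n (≤aₙ (<⇒≤ c<a₁))) (mid≢n R-mid))
        (T-diagonal-distinct (cell-mid R-mid c≤a_R) (cell-1 c<a₁) (above-1 R-mid)))
    where c<a₁ = <a₁ c≤a₁∸1

  row-n-vs-mid-next : ∀ {R} → Middle R → ∀ c → suc c ≤ row a R → c ≤ a₁ ∸ 1 →
    (ent U n c ≡ᵇ ent T R (suc c)) ≡ false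
  row-n-vs-mid-next {R} R-mid c c<a_R c≤a₁∸1 =
    trans (cong (_≡ᵇ ent T R (suc c)) (U-row-n c))
      (if-both (λ e → (e ≡ᵇ ent T R (suc c)) ≡ false) (f (suc c))
        (T-diagonal-distinct (cell-n (≤aₙ (<⇒≤ c<a₁))) (cell-mid R-mid c<a_R) (below-n R-mid))
        (T-column-distinct (cell-1 c<a₁) (cell-mid R-mid c<a_R) (≢-sym (mid≢1 R-mid))))
    where c<a₁ = <a₁ c≤a₁∸1

  middle : ∀ {R} → 1 ≤ R → R ≤ n → R ≢ 1 → R ≢ n → Middle R
  middle {R} 1≤R R≤n R≢1 R≢n = record { above-1 = strict 1≤R (≢-sym R≢1) ; below-n = strict R≤n R≢n }
    where
    strict : ∀ {p q} → p ≤ q → p ≢ q → p < q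
    strict p≤q p≢q with m≤n⇒m<n∨m≡n p≤q
    ... | inj₁ p<q = p<q
    ... | inj₂ p≡q = ⊥-elim (p≢q p≡q)

  b-cell-1 : ∀ {c} → Cell n b 1 c → c ≤ aₙ + 1
  b-cell-1 (_ , _ , c≤) = subst (_ ≤_) row-b-1 c≤

  b-cell-n : ∀ {c} → Cell n b n c → c ≤ a₁ ∸ 1
  b-cell-n (_ , _ , c≤) = subst (_ ≤_) row-b-n c≤

  row-b-other′ : ∀ {R c} → R ≢ 1 → R ≢ n → Cell n b R c → row b R ≡ row a R
  row-b-other′ R≢1 R≢n (1≤R , R≤n , _) = row-b-other 1≤R R≤n R≢1 R≢n

  b-cell-other : ∀ {R c} → R ≢ 1 → R ≢ n → Cell n b R c → Cell n a R c
  b-cell-other R≢1 R≢n cell@(1≤R , R≤n , c≤) = 1≤R , R≤n , subst (_ ≤_) (row-b-other′ R≢1 R≢n cell) c≤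

  middle-of : ∀ {R c} → R ≢ 1 → R ≢ n → Cell n b R c → Middle R
  middle-of R≢1 R≢n (1≤R , R≤n , _) = middle 1≤R R≤n R≢1 R≢n

  InRange : ℕ → Set
  InRange e = 1 ≤ e × e ≤ n

  U-entries : Entries n b U
  U-entries R zero (_ , ())
  U-entries R (suc k) (cell , _) with R ≟ 1 | R ≟ n
  ... | yes refl | _        = row-1 k (b-cell-1 cell)
    where
    row-1 : ∀ k → suc k ≤ aₙ + 1 → InRange (U 1 (suc k))
    row-1 zero    _ = subst InRange (sym U-row-1-first) (T-entry-bounds (cell-1 a₁>0))
    row-1 (suc k) k+2≤aₙ+1 with suc (suc k) ≤? a₁
    ... | yes k+2≤a₁ =
      subst InRange (sym (U-row-1-short (suc k) k+2≤a₁))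
        (if-both InRange (f (suc (suc k))) (T-entry-bounds (cell-1 k+2≤a₁)) (T-entry-bounds (cell-n (≤aₙ (<⇒≤ k+2≤a₁)))))
    ... | no k+2≰a₁ = subst InRange (sym (U-row-1-long (suc k) (≰⇒> k+2≰a₁))) (T-entry-bounds (cell-n (≤aₙ+1 k+2≤aₙ+1)))
  ... | no _     | yes refl =
    subst InRange (sym (U-row-n (suc k)))
      (if-both InRange (f (suc (suc k))) (T-entry-bounds (cell-n (≤aₙ (<⇒≤ k+2≤a₁)))) (T-entry-bounds (cell-1 k+2≤a₁)))
    where k+2≤a₁ = <a₁ (b-cell-n cell)
  ... | no R≢1   | no R≢n   =
    subst InRange (sym (U-other R≢1 R≢n (suc k))) (T-entry-bounds (b-cell-other R≢1 R≢n cell))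

  typeI-by-rows : ∀ R c S → Cell n b R c → Cell n b R (suc c) → Cell n b S c → R < S → row b S < row b R →
    coinvB (ent U R c) 0 (ent U R (suc c)) 1 (ent U S c) 0 ≡ false
  typeI-by-rows R c S cell-R-c cell-R-c+1 cell-S R<S b_S<b_R with R ≟ 1 | R ≟ n | S ≟ 1 | S ≟ n
  ... | yes refl | _        | yes refl | _        = ⊥-elim (<-irrefl refl R<S)
  ... | yes refl | _        | no _     | yes refl = typeI-window c (b-cell-n cell-S)
  ... | yes refl | _        | no S≢1   | no S≢n   =
    trans (cong (λ γ → coinvB (ent U 1 c) 0 (ent U 1 (suc c)) 1 γ 0) (U-other S≢1 S≢n c))
      (typeI-row-1 (middle-of S≢1 S≢n cell-S) c (proj₂ (proj₂ (b-cell-other S≢1 S≢n cell-S)))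
        (≤aₙ+1 (subst₂ _<_ (row-b-other′ S≢1 S≢n cell-S) row-b-1 b_S<b_R))
        (b-cell-1 cell-R-c+1))
  ... | no _     | yes refl | _        | _        = ⊥-elim (<⇒≱ R<S (proj₁ (proj₂ cell-S)))
  ... | no R≢1   | no R≢n   | yes refl | _        = ⊥-elim (<⇒≱ R<S (proj₁ cell-R-c))
  ... | no R≢1   | no R≢n   | no _     | yes refl =
    trans (cong₂ (λ α β → coinvB α 0 β 1 (ent U n c) 0) (U-other R≢1 R≢n c) (U-other R≢1 R≢n (suc c)))
      (typeI-row-n (middle-of R≢1 R≢n cell-R-c) c (proj₂ (proj₂ (b-cell-other R≢1 R≢n cell-R-c+1)))
        (a₁∸1< (subst₂ _<_ row-b-n (row-b-other′ R≢1 R≢n cell-R-c) b_S<b_R)) (b-cell-n cell-S))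
    where
    a₁∸1< : ∀ {L} → a₁ ∸ 1 < L → a₁ ≤ L
    a₁∸1< = shift a₁>0
      where
      shift : ∀ {z L} → 0 < z → z ∸ 1 < L → z ≤ L
      shift {suc z} _ z<L = z<L
  ... | no R≢1   | no R≢n   | no S≢1   | no S≢n   =
    trans (coinvB-cong 0 1 0 (U-other R≢1 R≢n c) (U-other R≢1 R≢n (suc c)) (U-other S≢1 S≢n c))
      (T-typeI (b-cell-other R≢1 R≢n cell-R-c) (b-cell-other R≢1 R≢n cell-R-c+1) (b-cell-other S≢1 S≢n cell-S) R<S
        (subst₂ _<_ (row-b-other′ S≢1 S≢n cell-S) (row-b-other′ R≢1 R≢n cell-R-c) b_S<b_R))

  U-typeI : NoCoInvI n b U
  U-typeI R c S cell-R-c cell-R-c+1 cell-S R<S b_S<b_R =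
    trans (coinvI-columns c (ent U R c) (ent U R (suc c)) (ent U S c))
      (typeI-by-rows R c S cell-R-c cell-R-c+1 cell-S R<S b_S<b_R)

  typeII-by-rows : ∀ R c S → Cell n b R c → Cell n b R (suc c) → Cell n b S (suc c) → S < R →
    row b S ≤ row b R →
    coinvB (ent U R c) 0 (ent U R (suc c)) 1 (ent U S (suc c)) 1 ≡ false
  typeII-by-rows R c S cell-R-c cell-R-c+1 cell-S S<R b_S≤b_R with R ≟ 1 | R ≟ n | S ≟ 1 | S ≟ n
  ... | yes refl | _        | _        | _        = ⊥-elim (<⇒≱ S<R (proj₁ cell-S))
  ... | no _     | yes refl | yes refl | _        =
    ⊥-elim (<-irrefl refl (≤-trans (subst₂ _≤_ (+-comm aₙ 1) row-b-n (subst (_≤ row b n) row-b-1 b_S≤b_R))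
                                   (≤-trans (m∸n≤m a₁ 1) a₁≤aₙ)))
  ... | no _     | yes refl | no _     | yes refl = ⊥-elim (<-irrefl refl S<R)
  ... | no _     | yes refl | no S≢1   | no S≢n   =
    trans (cong (λ γ → coinvB (ent U n c) 0 (ent U n (suc c)) 1 γ 1) (U-other S≢1 S≢n (suc c)))
      (typeII-row-n (middle-of S≢1 S≢n cell-S) c (proj₂ (proj₂ (b-cell-other S≢1 S≢n cell-S)))
        (subst₂ _≤_ (row-b-other′ S≢1 S≢n cell-S) row-b-n b_S≤b_R) (b-cell-n cell-R-c+1))
  ... | no R≢1   | no R≢n   | yes refl | _        =
    trans (cong₂ (λ α β → coinvB α 0 β 1 (ent U 1 (suc c)) 1) (U-other R≢1 R≢n c) (U-other R≢1 R≢n (suc c)))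
      (typeII-row-1 (middle-of R≢1 R≢n cell-R-c) c (proj₂ (proj₂ (b-cell-other R≢1 R≢n cell-R-c+1)))
        (subst₂ _≤_ row-b-1 (row-b-other′ R≢1 R≢n cell-R-c) b_S≤b_R) (b-cell-1 cell-S))
  ... | no R≢1   | no R≢n   | no _     | yes refl = ⊥-elim (<⇒≱ S<R (proj₁ (proj₂ cell-R-c)))
  ... | no R≢1   | no R≢n   | no S≢1   | no S≢n   =
    trans (coinvB-cong 0 1 1 (U-other R≢1 R≢n c) (U-other R≢1 R≢n (suc c)) (U-other S≢1 S≢n (suc c)))
      (T-typeII (b-cell-other R≢1 R≢n cell-R-c) (b-cell-other R≢1 R≢n cell-R-c+1) (b-cell-other S≢1 S≢n cell-S) S<R
        (subst₂ _≤_ (row-b-other′ S≢1 S≢n cell-S) (row-b-other′ R≢1 R≢n cell-R-c) b_S≤b_R))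

  U-typeII : NoCoInvII n b U
  U-typeII R c S cell-R-c cell-R-c+1 cell-S S<R b_S≤b_R =
    trans (coinvII-columns c (ent U R c) (ent U R (suc c)) (ent U S (suc c)))
      (typeII-by-rows R c S cell-R-c cell-R-c+1 cell-S S<R b_S≤b_R)

  rows-1-n-nonattacking : ∀ c₁ c₂ → Cell n b 1 c₁ → Cell n b n c₂ →
    attackB 1 c₁ (ent U 1 c₁) n c₂ (ent U n c₂) ≡ false
  rows-1-n-nonattacking c₁ c₂ cell₁ cell₂ = attackB-false 1 c₁ (ent U 1 c₁) n c₂ (ent U n c₂) same next prev
    where
    same : c₁ ≡ c₂ → 1 ≢ n → (ent U 1 c₁ ≡ᵇ ent U n c₂) ≡ false
    same refl _ = window-column-distinct c₁ (b-cell-n cell₂)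
    next : c₂ ≡ suc c₁ → n < 1 → (ent U 1 c₁ ≡ᵇ ent U n c₂) ≡ false
    next _ n<1 = ⊥-elim (<-irrefl refl (<-trans n<1 1<n))
    prev : c₁ ≡ suc c₂ → 1 < n → (ent U 1 c₁ ≡ᵇ ent U n c₂) ≡ false
    prev refl _ = ≢ᵇ-sym (ent U n c₂) (ent U 1 (suc c₂)) (window-diagonal-distinct c₂ (b-cell-n cell₂))

  row-1-mid-nonattacking : ∀ {R} → R ≢ 1 → R ≢ n → ∀ c₁ c₂ → Cell n b 1 c₁ → Cell n b R c₂ →
    attackB 1 c₁ (ent U 1 c₁) R c₂ (ent U R c₂) ≡ false
  row-1-mid-nonattacking {R} R≢1 R≢n c₁ c₂ cell₁ cell₂ =
    attackB-false 1 c₁ (ent U 1 c₁) R c₂ (ent U R c₂) same next prev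
    where
    R-mid = middle-of R≢1 R≢n cell₂
    c₂≤a_R = proj₂ (proj₂ (b-cell-other R≢1 R≢n cell₂))
    same : c₁ ≡ c₂ → 1 ≢ R → (ent U 1 c₁ ≡ᵇ ent U R c₂) ≡ false
    same refl _ = trans (cong (ent U 1 c₁ ≡ᵇ_) (U-other R≢1 R≢n c₁))
      (≢ᵇ-sym (ent T R c₁) (ent U 1 c₁) (mid-vs-row-1 R-mid c₁ c₂≤a_R (b-cell-1 cell₁)))
    next : c₂ ≡ suc c₁ → R < 1 → (ent U 1 c₁ ≡ᵇ ent U R c₂) ≡ false
    next _ R<1 = ⊥-elim (<⇒≱ R<1 (proj₁ cell₂))
    prev : c₁ ≡ suc c₂ → 1 < R → (ent U 1 c₁ ≡ᵇ ent U R c₂) ≡ false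
    prev refl _ = trans (cong (ent U 1 (suc c₂) ≡ᵇ_) (U-other R≢1 R≢n c₂))
      (≢ᵇ-sym (ent T R c₂) (ent U 1 (suc c₂)) (mid-vs-row-1-next R-mid c₂ c₂≤a_R (b-cell-1 cell₁)))

  row-n-mid-nonattacking : ∀ {R} → R ≢ 1 → R ≢ n → ∀ c₁ c₂ → Cell n b n c₁ → Cell n b R c₂ →
    attackB n c₁ (ent U n c₁) R c₂ (ent U R c₂) ≡ false
  row-n-mid-nonattacking {R} R≢1 R≢n c₁ c₂ cell₁ cell₂ =
    attackB-false n c₁ (ent U n c₁) R c₂ (ent U R c₂) same next prev
    where
    R-mid = middle-of R≢1 R≢n cell₂
    c₂≤a_R = proj₂ (proj₂ (b-cell-other R≢1 R≢n cell₂))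
    same : c₁ ≡ c₂ → n ≢ R → (ent U n c₁ ≡ᵇ ent U R c₂) ≡ false
    same refl _ = trans (cong (ent U n c₁ ≡ᵇ_) (U-other R≢1 R≢n c₁))
      (≢ᵇ-sym (ent T R c₁) (ent U n c₁) (mid-vs-row-n R-mid c₁ c₂≤a_R (b-cell-n cell₁)))
    next : c₂ ≡ suc c₁ → R < n → (ent U n c₁ ≡ᵇ ent U R c₂) ≡ false
    next refl _ = trans (cong (ent U n c₁ ≡ᵇ_) (U-other R≢1 R≢n (suc c₁)))
      (row-n-vs-mid-next R-mid c₁ c₂≤a_R (b-cell-n cell₁))
    prev : c₁ ≡ suc c₂ → n < R → (ent U n c₁ ≡ᵇ ent U R c₂) ≡ false
    prev _ n<R = ⊥-elim (<⇒≱ n<R (proj₁ (proj₂ cell₂)))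

  data RowKind (R : ℕ) : Set where
    first  : R ≡ 1 → RowKind R
    last   : R ≡ n → RowKind R
    inside : R ≢ 1 → R ≢ n → RowKind R

  row-kind : ∀ R → RowKind R
  row-kind R with R ≟ 1 | R ≟ n
  ... | yes R≡1 | _       = first R≡1
  ... | no _    | yes R≡n = last R≡n
  ... | no R≢1  | no R≢n  = inside R≢1 R≢n

  U-nonattacking : NonAttacking n b U
  U-nonattacking R₁ c₁ R₂ c₂ cell₁ cell₂ with row-kind R₁ | row-kind R₂
  ... | first refl | first refl = attackB-same-row 1 c₁ (ent U 1 c₁) c₂ (ent U 1 c₂)
  ... | last refl  | last refl  = attackB-same-row R₁ c₁ (ent U R₁ c₁) c₂ (ent U R₁ c₂)
  ... | first refl | last refl  = rows-1-n-nonattacking c₁ c₂ cell₁ cell₂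
  ... | last refl  | first refl =
    trans (attackB-sym R₁ c₁ (ent U R₁ c₁) 1 c₂ (ent U 1 c₂)) (rows-1-n-nonattacking c₂ c₁ cell₂ cell₁)
  ... | first refl | inside R₂≢1 R₂≢n = row-1-mid-nonattacking R₂≢1 R₂≢n c₁ c₂ cell₁ cell₂
  ... | inside R₁≢1 R₁≢n | first refl =
    trans (attackB-sym R₁ c₁ (ent U R₁ c₁) 1 c₂ (ent U 1 c₂)) (row-1-mid-nonattacking R₁≢1 R₁≢n c₂ c₁ cell₂ cell₁)
  ... | last refl  | inside R₂≢1 R₂≢n = row-n-mid-nonattacking R₂≢1 R₂≢n c₁ c₂ cell₁ cell₂
  ... | inside R₁≢1 R₁≢n | last refl =
    trans (attackB-sym R₁ c₁ (ent U R₁ c₁) R₂ c₂ (ent U R₂ c₂)) (row-n-mid-nonattacking R₁≢1 R₁≢n c₂ c₁ cell₂ cell₁)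
  ... | inside R₁≢1 R₁≢n | inside R₂≢1 R₂≢n
    rewrite U-other R₁≢1 R₁≢n c₁ | U-other R₂≢1 R₂≢n c₂ =
    T-nonattacking R₁ c₁ R₂ c₂ (b-cell-other R₁≢1 R₁≢n cell₁) (b-cell-other R₂≢1 R₂≢n cell₂)

  E0-sskd : SSKD n b U
  E0-sskd = U-entries , U-nonattacking , U-typeI , U-typeII

theorem4p5 : (n : ℕ) → 2 ≤ n → (i : ℕ) → i < n → (a : Vec ℕ n) →
    Cond n i a → (T : Filling) → SSKD n a T → SSKD n (sAct n i a) (E n i a T)
theorem4p5 n 2≤n zero    i<n a (a₁≤aₙ , a₁>0) T T-sskd = E0Proof.E0-sskd n a T T-sskd 2≤n a₁≤aₙ a₁>0
theorem4p5 n 2≤n (suc j) i<n a shorter        T T-sskd = EiProof.Ei-sskd n j a T T-sskd shorter i<n
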